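{- Let $k$ be a positive integer and $p$ a prime with $p\equiv 3\pmod 4$. Then for all integers $n\ge 0$, $$pod_3\left(p^{2k}n+\frac{p^{2k}-1}{4}\right)\equiv pod_3(n)\pmod 3.$$
   Context: $pod_3(n)$ denotes the number of partitions of $n$ in which no part is divisible by $3$, the odd parts are distinct, and the even parts are unrestricted (with $pod_3(0)=1$); equivalently $\sum_{n\ge0}pod_3(n)q^n=\psi(-q^3)/\psi(-q)$, where $\psi(q)=\sum_{n\ge0}q^{n(n+1)/2}$. -}

module Defs where

open import Data.Nat using (ℕ; zero; suc; _+_; _*_; _∸_; _≤?_; _^_)
open import Data.Nat.DivMod using (_%_; _/_)
open import Data.Bool using (Bool; true; false; if_then_else_)
open import Relation.Nullary.Decidable using (⌊_⌋)

-- pod₃-bounded n m : number of partitions of n into parts ≤ m such that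
-- no part is divisible by 3 and odd parts are distinct (even parts unrestricted).
mutual
  pod₃-bounded : ℕ → ℕ → ℕ
  pod₃-bounded zero    zero    = 1
  pod₃-bounded (suc _) zero    = 0
  pod₃-bounded n       (suc m) = withPart (suc m) n m

  withPart : ℕ → ℕ → ℕ → ℕ
  withPart s n m with s % 3
  ... | zero  = pod₃-bounded n m
  ... | suc _ with s % 2
  ...   | zero  = evenMult n n s m       -- even: any multiplicity
  ...   | suc _ = pod₃-bounded n m +     -- odd: multiplicity 0 or 1
                  (if ⌊ s ≤? n ⌋ then pod₃-bounded (n ∸ s) m else 0)

  -- evenMult fuel n s m = Σ_{j ≥ 0, j s ≤ n} pod₃-bounded (n - j s) m
  -- (fuel ≥ n suffices since s ≥ 1)
  evenMult : ℕ → ℕ → ℕ → ℕ → ℕ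
  evenMult zero       n s m = pod₃-bounded n m
  evenMult (suc fuel) n s m =
    pod₃-bounded n m + (if ⌊ s ≤? n ⌋ then evenMult fuel (n ∸ s) s m else 0)

pod₃ : ℕ → ℕ
pod₃ n = pod₃-bounded n n

{-# OPTIONS --safe #-}
-- Work with formal power series over 𝔽₃ and let ψ(q) = Σ_k q^(k(k+1)/2). Gauss's identity
-- ψ(q) = (q²;q²)∞ / (q;q²)∞, obtained here as the limit of a finite Jacobi-type q-binomial
-- identity, turns the product formula for pod₃ into Σ pod₃(n) (-q)ⁿ = ψ(q³) / ψ(q). Modulo 3,
-- ψ(q³) = ψ(q)³, so (-1)ⁿ pod₃(n) ≡ r(n), the number of pairs (a, b) with n = T(a) + T(b)
-- for triangular numbers T. Now 8n + 2 = (2a + 1)² + (2b + 1)², and a prime p ≡ 3 (mod 4)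
-- dividing a sum of two squares divides both, so every representation of p²m + (p² - 1)/4
-- has a ≡ b ≡ (p - 1)/2 (mod p) and comes from a representation of m. Hence
-- r(p²m + (p² - 1)/4) = r(m), and iterating k times gives the congruence.
module Submission where

open import Defs
open import Algebra.Bundles using (CommutativeSemiring)
open import Data.Bool using (if_then_else_)
open import Data.Empty using (⊥-elim)
open import Data.Nat using (ℕ; zero; suc; _+_; _*_; _∸_; _^_; _≤_; _<_; z≤n; s≤s; _≤?_)
open import Data.Nat.Coprimality using (Coprime; coprime-Bézout)
open import Data.Nat.DivMod
  using (_%_; _/_; m≡m%n+[m/n]*n; m%n<n; [m+n]%n≡m%n; [m+kn]%n≡m%n; %-distribˡ-+; %-distribˡ-*; m<n⇒m%n≡m;
         m*n%n≡0; m*n/n≡m)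
open import Data.Nat.Divisibility using (_∣_; divides; _∣?_; ∣m∣n⇒∣m+n; ∣⇒≤; n∣m⇒m%n≡0; m∣m*n; ∣-trans)
import Data.Nat.GCD as GCD
open import Data.Nat.Primality using (Prime; euclidsLemma; prime⇒irreducible)
open import Data.Nat.Properties
  using (_≟_; suc-injective; ≤-refl; ≤-trans; ≤-pred; n≤1+n; m≤n⇒m≤1+n; <-irrefl; <-trans; <⇒≱; ≰⇒>;
         m≤n⇒m<n∨m≡n; m≤n⇒∃[o]m+o≡n; +-comm; +-assoc; +-suc; +-identityʳ; +-cancelˡ-≡; +-cancelʳ-≡;
         m≤m+n; m≤n+m; +-monoˡ-≤; +-monoʳ-≤; +-monoʳ-<; m+n∸m≡n; m+n∸n≡m; ∸-monoʳ-≤; ∸-monoˡ-≤;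
         *-comm; *-assoc; *-suc; *-identityˡ; *-identityʳ; *-zeroʳ; *-distribˡ-+; *-distribʳ-+;
         *-cancelˡ-≡; *-cancelʳ-≡; *-monoʳ-≤; m≤m*n; m≤n*m; ^-*-assoc)
open import Data.Nat.Tactic.RingSolver using (solve-∀)
open import Data.Product using (Σ; ∃; _×_; _,_; proj₁; proj₂)
open import Data.Sum using (_⊎_; inj₁; inj₂)
open import Relation.Binary.Definitions using (DecidableEquality)
open import Relation.Binary.PropositionalEquality
  using (_≡_; _≢_; refl; sym; trans; cong; cong₂; subst; module ≡-Reasoning)
open import Relation.Nullary using (¬_; Dec; yes; no)
open import Relation.Nullary.Decidable using (True; toWitness; _→-dec_; ⌊_⌋)

data 𝔽₃ : Set where
  0₃ 1₃ 2₃ : 𝔽₃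

infixl 6 _⊕_
infixl 7 _⊗_
infix 4 _≟₃_

_⊕_ : 𝔽₃ → 𝔽₃ → 𝔽₃
0₃ ⊕ y  = y
x  ⊕ 0₃ = x
1₃ ⊕ 1₃ = 2₃
2₃ ⊕ 2₃ = 1₃
_  ⊕ _  = 0₃

_⊗_ : 𝔽₃ → 𝔽₃ → 𝔽₃
0₃ ⊗ _  = 0₃
1₃ ⊗ y  = y
2₃ ⊗ 0₃ = 0₃
2₃ ⊗ 1₃ = 2₃
2₃ ⊗ 2₃ = 1₃

_≟₃_ : DecidableEquality 𝔽₃
0₃ ≟₃ 0₃ = yes refl
1₃ ≟₃ 1₃ = yes refl
2₃ ≟₃ 2₃ = yes refl
0₃ ≟₃ 1₃ = no λ ()
0₃ ≟₃ 2₃ = no λ ()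
1₃ ≟₃ 0₃ = no λ ()
1₃ ≟₃ 2₃ = no λ ()
2₃ ≟₃ 0₃ = no λ ()
2₃ ≟₃ 1₃ = no λ ()

all? : {P : 𝔽₃ → Set} → (∀ x → Dec (P x)) → Dec (∀ x → P x)
all? P? with P? 0₃ | P? 1₃ | P? 2₃
... | yes p₀ | yes p₁ | yes p₂ = yes λ { 0₃ → p₀ ; 1₃ → p₁ ; 2₃ → p₂ }
... | no ¬p  | _      | _      = no λ p → ¬p (p 0₃)
... | _      | no ¬p  | _      = no λ p → ¬p (p 1₃)
... | _      | _      | no ¬p  = no λ p → ¬p (p 2₃)

by-exhaustion¹ : {P : 𝔽₃ → Set} (P? : ∀ x → Dec (P x)) →
                 {True (all? P?)} → ∀ x → P x
by-exhaustion¹ _ {t} = toWitness t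

by-exhaustion² : {P : 𝔽₃ → 𝔽₃ → Set} (P? : ∀ x y → Dec (P x y)) →
                 {True (all? λ x → all? (P? x))} → ∀ x y → P x y
by-exhaustion² _ {t} = toWitness t

by-exhaustion³ : {P : 𝔽₃ → 𝔽₃ → 𝔽₃ → Set} (P? : ∀ x y z → Dec (P x y z)) →
                 {True (all? λ x → all? λ y → all? (P? x y))} → ∀ x y z → P x y z
by-exhaustion³ _ {t} = toWitness t

⊕-assoc : ∀ x y z → (x ⊕ y) ⊕ z ≡ x ⊕ (y ⊕ z)
⊕-assoc = by-exhaustion³ λ x y z → (x ⊕ y) ⊕ z ≟₃ x ⊕ (y ⊕ z)

⊕-comm : ∀ x y → x ⊕ y ≡ y ⊕ x
⊕-comm = by-exhaustion² λ x y → x ⊕ y ≟₃ y ⊕ x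

⊕-identityʳ : ∀ x → x ⊕ 0₃ ≡ x
⊕-identityʳ = by-exhaustion¹ λ x → x ⊕ 0₃ ≟₃ x

⊕-cancelˡ : ∀ x y z → x ⊕ y ≡ x ⊕ z → y ≡ z
⊕-cancelˡ = by-exhaustion³ λ x y z → (x ⊕ y ≟₃ x ⊕ z) →-dec (y ≟₃ z)

x⊕x⊕x≡0 : ∀ x → x ⊕ x ⊕ x ≡ 0₃
x⊕x⊕x≡0 = by-exhaustion¹ λ x → x ⊕ x ⊕ x ≟₃ 0₃

⊗-assoc : ∀ x y z → (x ⊗ y) ⊗ z ≡ x ⊗ (y ⊗ z)
⊗-assoc = by-exhaustion³ λ x y z → (x ⊗ y) ⊗ z ≟₃ x ⊗ (y ⊗ z)

⊗-comm : ∀ x y → x ⊗ y ≡ y ⊗ x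
⊗-comm = by-exhaustion² λ x y → x ⊗ y ≟₃ y ⊗ x

⊗-identityʳ : ∀ x → x ⊗ 1₃ ≡ x
⊗-identityʳ = by-exhaustion¹ λ x → x ⊗ 1₃ ≟₃ x

⊗-zeroʳ : ∀ x → x ⊗ 0₃ ≡ 0₃
⊗-zeroʳ = by-exhaustion¹ λ x → x ⊗ 0₃ ≟₃ 0₃

⊗-distribˡ-⊕ : ∀ x y z → x ⊗ (y ⊕ z) ≡ x ⊗ y ⊕ x ⊗ z
⊗-distribˡ-⊕ = by-exhaustion³ λ x y z → x ⊗ (y ⊕ z) ≟₃ x ⊗ y ⊕ x ⊗ z

⊗-distribʳ-⊕ : ∀ x y z → (y ⊕ z) ⊗ x ≡ y ⊗ x ⊕ z ⊗ x
⊗-distribʳ-⊕ = by-exhaustion³ λ x y z → (y ⊕ z) ⊗ x ≟₃ y ⊗ x ⊕ z ⊗ x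

2⊗[x⊕x]≡x : ∀ x → 2₃ ⊗ (x ⊕ x) ≡ x
2⊗[x⊕x]≡x = by-exhaustion¹ λ x → 2₃ ⊗ (x ⊕ x) ≟₃ x

-- Formal power series over 𝔽₃
Series : Set
Series = ℕ → 𝔽₃

infix 4 _≈_ _≈[_]_

_≈_ : Series → Series → Set
f ≈ g = ∀ n → f n ≡ g n

-- Agreement modulo q ^ K.
_≈[_]_ : Series → ℕ → Series → Set
f ≈[ K ] g = ∀ n → n < K → f n ≡ g n

≈-refl : ∀ {f} → f ≈ f
≈-refl n = refl

≈-sym : ∀ {f g} → f ≈ g → g ≈ f
≈-sym p n = sym (p n)

≈-trans : ∀ {f g h} → f ≈ g → g ≈ h → f ≈ h
≈-trans p q n = trans (p n) (q n)

≈[]-refl : ∀ {f K} → f ≈[ K ] f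
≈[]-refl n _ = refl

≈[]-sym : ∀ {f g K} → f ≈[ K ] g → g ≈[ K ] f
≈[]-sym p n l = sym (p n l)

≈[]-trans : ∀ {f g h K} → f ≈[ K ] g → g ≈[ K ] h → f ≈[ K ] h
≈[]-trans p q n l = trans (p n l) (q n l)

≈⇒≈[] : ∀ {f g K} → f ≈ g → f ≈[ K ] g
≈⇒≈[] p n _ = p n

≈[]-weaken : ∀ {f g K L} → L ≤ K → f ≈[ K ] g → f ≈[ L ] g
≈[]-weaken L≤K p n l = p n (≤-trans l L≤K)

tail : Series → Series
tail f n = f (suc n)

const : 𝔽₃ → Series
const c zero    = c
const c (suc n) = 0₃

0ₛ : Series
0ₛ _ = 0₃

1ₛ -1ₛ : Series
1ₛ  = const 1₃
-1ₛ = const 2₃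

infixl 6 _+ₛ_
infixl 7 _*ₛ_ _·ₛ_

_+ₛ_ : Series → Series → Series
(f +ₛ g) n = f n ⊕ g n

_·ₛ_ : 𝔽₃ → Series → Series
(c ·ₛ f) n = c ⊗ f n

_*ₛ_ : Series → Series → Series
(f *ₛ g) zero    = f 0 ⊗ g 0
(f *ₛ g) (suc n) = f 0 ⊗ g (suc n) ⊕ (tail f *ₛ g) n

*ₛ-local : ∀ n f f′ g g′ → (∀ i → i ≤ n → f i ≡ f′ i) → (∀ i → i ≤ n → g i ≡ g′ i) →
           (f *ₛ g) n ≡ (f′ *ₛ g′) n
*ₛ-local zero    f f′ g g′ pf pg = cong₂ _⊗_ (pf 0 z≤n) (pg 0 z≤n)
*ₛ-local (suc n) f f′ g g′ pf pg =
  cong₂ _⊕_ (cong₂ _⊗_ (pf 0 z≤n) (pg (suc n) ≤-refl))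
            (*ₛ-local n (tail f) (tail f′) g g′ (λ i l → pf (suc i) (s≤s l)) (λ i l → pg i (m≤n⇒m≤1+n l)))

*ₛ-cong : ∀ {f f′ g g′} → f ≈ f′ → g ≈ g′ → f *ₛ g ≈ f′ *ₛ g′
*ₛ-cong {f} {f′} {g} {g′} pf pg n = *ₛ-local n f f′ g g′ (λ i _ → pf i) (λ i _ → pg i)

*ₛ-cong[] : ∀ {f f′ g g′ K} → f ≈[ K ] f′ → g ≈[ K ] g′ → f *ₛ g ≈[ K ] f′ *ₛ g′
*ₛ-cong[] {f} {f′} {g} {g′} pf pg n l =
  *ₛ-local n f f′ g g′ (λ i i≤n → pf i (≤-trans (s≤s i≤n) l)) (λ i i≤n → pg i (≤-trans (s≤s i≤n) l))

+ₛ-cong : ∀ {f f′ g g′} → f ≈ f′ → g ≈ g′ → f +ₛ g ≈ f′ +ₛ g′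
+ₛ-cong pf pg n = cong₂ _⊕_ (pf n) (pg n)

+ₛ-cong[] : ∀ {f f′ g g′ K} → f ≈[ K ] f′ → g ≈[ K ] g′ → f +ₛ g ≈[ K ] f′ +ₛ g′
+ₛ-cong[] pf pg n l = cong₂ _⊕_ (pf n l) (pg n l)

*ₛ-sucʳ : ∀ n f g → (f *ₛ g) (suc n) ≡ (f *ₛ tail g) n ⊕ f (suc n) ⊗ g 0
*ₛ-sucʳ zero    f g = refl
*ₛ-sucʳ (suc n) f g = trans (cong (f 0 ⊗ g (suc (suc n)) ⊕_) (*ₛ-sucʳ n (tail f) g)) (sym (⊕-assoc (f 0 ⊗ g (suc (suc n))) ((tail f *ₛ tail g) n) (f (suc (suc n)) ⊗ g 0)))

*ₛ-comm : ∀ f g → f *ₛ g ≈ g *ₛ f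
*ₛ-comm f g zero    = ⊗-comm (f 0) (g 0)
*ₛ-comm f g (suc n) = begin
  f 0 ⊗ g (suc n) ⊕ (tail f *ₛ g) n   ≡⟨ cong₂ _⊕_ (⊗-comm (f 0) (g (suc n))) (*ₛ-comm (tail f) g n) ⟩
  g (suc n) ⊗ f 0 ⊕ (g *ₛ tail f) n   ≡⟨ ⊕-comm (g (suc n) ⊗ f 0) ((g *ₛ tail f) n) ⟩
  (g *ₛ tail f) n ⊕ g (suc n) ⊗ f 0   ≡⟨ *ₛ-sucʳ n g f ⟨
  (g *ₛ f) (suc n)                    ∎
  where open ≡-Reasoning

⊕-interchange : ∀ a b c d → (a ⊕ b) ⊕ (c ⊕ d) ≡ (a ⊕ c) ⊕ (b ⊕ d)
⊕-interchange a b c d = begin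
  (a ⊕ b) ⊕ (c ⊕ d)   ≡⟨ ⊕-assoc a b (c ⊕ d) ⟩
  a ⊕ (b ⊕ (c ⊕ d))   ≡⟨ cong (a ⊕_) (⊕-assoc b c d) ⟨
  a ⊕ ((b ⊕ c) ⊕ d)   ≡⟨ cong (λ x → a ⊕ (x ⊕ d)) (⊕-comm b c) ⟩
  a ⊕ ((c ⊕ b) ⊕ d)   ≡⟨ cong (a ⊕_) (⊕-assoc c b d) ⟩
  a ⊕ (c ⊕ (b ⊕ d))   ≡⟨ ⊕-assoc a c (b ⊕ d) ⟨
  (a ⊕ c) ⊕ (b ⊕ d)   ∎
  where open ≡-Reasoning

+ₛ-interchange : ∀ f g h k → (f +ₛ g) +ₛ (h +ₛ k) ≈ (f +ₛ h) +ₛ (g +ₛ k)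
+ₛ-interchange f g h k n = ⊕-interchange (f n) (g n) (h n) (k n)

*ₛ-distribʳ-+ₛ : ∀ f f′ g → (f +ₛ f′) *ₛ g ≈ f *ₛ g +ₛ f′ *ₛ g
*ₛ-distribʳ-+ₛ f f′ g zero    = ⊗-distribʳ-⊕ (g 0) (f 0) (f′ 0)
*ₛ-distribʳ-+ₛ f f′ g (suc n) =
  trans (cong₂ _⊕_ (⊗-distribʳ-⊕ (g (suc n)) (f 0) (f′ 0)) (*ₛ-distribʳ-+ₛ (tail f) (tail f′) g n))
        (⊕-interchange (f 0 ⊗ g (suc n)) (f′ 0 ⊗ g (suc n)) ((tail f *ₛ g) n) ((tail f′ *ₛ g) n))

*ₛ-distribˡ-+ₛ : ∀ f g g′ → f *ₛ (g +ₛ g′) ≈ f *ₛ g +ₛ f *ₛ g′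
*ₛ-distribˡ-+ₛ f g g′ n =
  trans (*ₛ-comm f (g +ₛ g′) n) (trans (*ₛ-distribʳ-+ₛ g g′ f n) (cong₂ _⊕_ (*ₛ-comm g f n) (*ₛ-comm g′ f n)))

·ₛ-*ₛ-assoc : ∀ c f g → c ·ₛ f *ₛ g ≈ c ·ₛ (f *ₛ g)
·ₛ-*ₛ-assoc c f g zero    = ⊗-assoc c (f 0) (g 0)
·ₛ-*ₛ-assoc c f g (suc n) =
  trans (cong₂ _⊕_ (⊗-assoc c (f 0) (g (suc n))) (·ₛ-*ₛ-assoc c (tail f) g n)) (sym (⊗-distribˡ-⊕ c _ _))

*ₛ-assoc : ∀ f g h → (f *ₛ g) *ₛ h ≈ f *ₛ (g *ₛ h)
*ₛ-assoc f g h zero    = ⊗-assoc (f 0) (g 0) (h 0)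
*ₛ-assoc f g h (suc n) = begin
  (f 0 ⊗ g 0) ⊗ h (suc n) ⊕ (tail (f *ₛ g) *ₛ h) n
    ≡⟨ cong ((f 0 ⊗ g 0) ⊗ h (suc n) ⊕_) tail-step ⟩
  (f 0 ⊗ g 0) ⊗ h (suc n) ⊕ (f 0 ⊗ (tail g *ₛ h) n ⊕ (tail f *ₛ (g *ₛ h)) n)
    ≡⟨ ⊕-assoc ((f 0 ⊗ g 0) ⊗ h (suc n)) (f 0 ⊗ (tail g *ₛ h) n) ((tail f *ₛ (g *ₛ h)) n) ⟨
  ((f 0 ⊗ g 0) ⊗ h (suc n) ⊕ f 0 ⊗ (tail g *ₛ h) n) ⊕ (tail f *ₛ (g *ₛ h)) n
    ≡⟨ cong (_⊕ (tail f *ₛ (g *ₛ h)) n)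
            (trans (cong (_⊕ f 0 ⊗ (tail g *ₛ h) n) (⊗-assoc (f 0) (g 0) (h (suc n))))
                   (sym (⊗-distribˡ-⊕ (f 0) (g 0 ⊗ h (suc n)) ((tail g *ₛ h) n)))) ⟩
  f 0 ⊗ (g 0 ⊗ h (suc n) ⊕ (tail g *ₛ h) n) ⊕ (tail f *ₛ (g *ₛ h)) n
    ∎
  where
  open ≡-Reasoning
  tail-step : (tail (f *ₛ g) *ₛ h) n ≡ f 0 ⊗ (tail g *ₛ h) n ⊕ (tail f *ₛ (g *ₛ h)) n
  tail-step = begin
    (tail (f *ₛ g) *ₛ h) n                            ≡⟨⟩
    ((f 0 ·ₛ tail g +ₛ tail f *ₛ g) *ₛ h) n           ≡⟨ *ₛ-distribʳ-+ₛ (f 0 ·ₛ tail g) (tail f *ₛ g) h n ⟩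
    (f 0 ·ₛ tail g *ₛ h) n ⊕ ((tail f *ₛ g) *ₛ h) n   ≡⟨ cong₂ _⊕_ (·ₛ-*ₛ-assoc (f 0) (tail g) h n) (*ₛ-assoc (tail f) g h n) ⟩
    f 0 ⊗ (tail g *ₛ h) n ⊕ (tail f *ₛ (g *ₛ h)) n    ∎

*ₛ-zeroˡ : ∀ f → 0ₛ *ₛ f ≈ 0ₛ
*ₛ-zeroˡ f zero    = refl
*ₛ-zeroˡ f (suc n) = *ₛ-zeroˡ f n

*ₛ-zeroʳ : ∀ f → f *ₛ 0ₛ ≈ 0ₛ
*ₛ-zeroʳ f n = trans (*ₛ-comm f 0ₛ n) (*ₛ-zeroˡ f n)

const-*ₛ : ∀ c f → const c *ₛ f ≈ c ·ₛ f
const-*ₛ c f zero    = refl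
const-*ₛ c f (suc n) = trans (cong (c ⊗ f (suc n) ⊕_) (*ₛ-zeroˡ f n)) (⊕-identityʳ _)

*ₛ-identityˡ : ∀ f → 1ₛ *ₛ f ≈ f
*ₛ-identityˡ = const-*ₛ 1₃

*ₛ-identityʳ : ∀ f → f *ₛ 1ₛ ≈ f
*ₛ-identityʳ f n = trans (*ₛ-comm f 1ₛ n) (*ₛ-identityˡ f n)

+ₛ-identityˡ : ∀ f → 0ₛ +ₛ f ≈ f
+ₛ-identityˡ f n = refl

+ₛ-identityʳ : ∀ f → f +ₛ 0ₛ ≈ f
+ₛ-identityʳ f n = ⊕-identityʳ (f n)

+ₛ-comm : ∀ f g → f +ₛ g ≈ g +ₛ f
+ₛ-comm f g n = ⊕-comm (f n) (g n)

+ₛ-assoc : ∀ f g h → (f +ₛ g) +ₛ h ≈ f +ₛ (g +ₛ h)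
+ₛ-assoc f g h n = ⊕-assoc (f n) (g n) (h n)

seriesSemiring : CommutativeSemiring _ _
seriesSemiring = record
  { Carrier = Series ; _≈_ = _≈_ ; _+_ = _+ₛ_ ; _*_ = _*ₛ_ ; 0# = 0ₛ ; 1# = 1ₛ
  ; isCommutativeSemiring = record
    { isSemiring = record
      { isSemiringWithoutAnnihilatingZero = record
        { +-isCommutativeMonoid = record
          { isMonoid = record
            { isSemigroup = record
              { isMagma = record
                { isEquivalence = record { refl = λ {f} → ≈-refl {f} ; sym = λ {f} {g} → ≈-sym {f} {g}
                                         ; trans = λ {f} {g} {h} → ≈-trans {f} {g} {h} }
                ; ∙-cong = λ {f} {f′} {g} {g′} → +ₛ-cong {f} {f′} {g} {g′} }
              ; assoc = +ₛ-assoc }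
            ; identity = +ₛ-identityˡ , +ₛ-identityʳ }
          ; comm = +ₛ-comm }
        ; *-cong = λ {f} {f′} {g} {g′} → *ₛ-cong {f} {f′} {g} {g′}
        ; *-assoc = *ₛ-assoc
        ; *-identity = *ₛ-identityˡ , *ₛ-identityʳ
        ; distrib = *ₛ-distribˡ-+ₛ , λ g f f′ → *ₛ-distribʳ-+ₛ f f′ g }
      ; zero = *ₛ-zeroˡ , *ₛ-zeroʳ }
    ; *-comm = *ₛ-comm } }

open import Algebra.Solver.Ring.NaturalCoefficients.Default seriesSemiring
  using (solve; _:+_; _:*_; _:=_; con)

module ≈-Reasoning where
  open import Relation.Binary.Reasoning.Setoid (CommutativeSemiring.setoid seriesSemiring) public

shift : ℕ → Series → Series
shift zero    f         = f
shift (suc k) f zero    = 0₃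
shift (suc k) f (suc n) = shift k f n

q^_ : ℕ → Series
q^ k = shift k 1ₛ

1-q^_ 1+q^_ : ℕ → Series
1-q^ k = 1ₛ +ₛ -1ₛ *ₛ q^ k
1+q^ k = 1ₛ +ₛ q^ k

shift-cong : ∀ k {f g} → f ≈ g → shift k f ≈ shift k g
shift-cong zero    p n       = p n
shift-cong (suc k) p zero    = refl
shift-cong (suc k) p (suc n) = shift-cong k p n

shift-cong[] : ∀ k {f g K} → f ≈[ K ] g → shift k f ≈[ k + K ] shift k g
shift-cong[] zero    p n       l       = p n l
shift-cong[] (suc k) p zero    l       = refl
shift-cong[] (suc k) p (suc n) (s≤s l) = shift-cong[] k p n l

shift-≡ : ∀ {a b} f → a ≡ b → shift a f ≈ shift b f
shift-≡ f refl = ≈-refl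

shift-+ₛ : ∀ k f g → shift k (f +ₛ g) ≈ shift k f +ₛ shift k g
shift-+ₛ zero    f g n       = refl
shift-+ₛ (suc k) f g zero    = refl
shift-+ₛ (suc k) f g (suc n) = shift-+ₛ k f g n

shift-0ₛ : ∀ k → shift k 0ₛ ≈ 0ₛ
shift-0ₛ zero    n       = refl
shift-0ₛ (suc k) zero    = refl
shift-0ₛ (suc k) (suc n) = shift-0ₛ k n

shift-shift : ∀ a b f → shift a (shift b f) ≈ shift (a + b) f
shift-shift zero    b f n       = refl
shift-shift (suc a) b f zero    = refl
shift-shift (suc a) b f (suc n) = shift-shift a b f n

shift-*ₛˡ : ∀ k f g → shift k f *ₛ g ≈ shift k (f *ₛ g)
shift-*ₛˡ zero    f g n       = refl
shift-*ₛˡ (suc k) f g zero    = refl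
shift-*ₛˡ (suc k) f g (suc n) = shift-*ₛˡ k f g n

shift-*ₛʳ : ∀ k f g → f *ₛ shift k g ≈ shift k (f *ₛ g)
shift-*ₛʳ k f g n = trans (*ₛ-comm f (shift k g) n) (trans (shift-*ₛˡ k g f n) (shift-cong k (*ₛ-comm g f) n))

shift≈q^-*ₛ : ∀ k f → shift k f ≈ q^ k *ₛ f
shift≈q^-*ₛ k f n = sym (trans (shift-*ₛˡ k 1ₛ f n) (shift-cong k (*ₛ-identityˡ f) n))

q^-*ₛ-shift : ∀ k j f → q^ j *ₛ shift k f ≈ shift (j + k) f
q^-*ₛ-shift k j f = ≈-trans (≈-sym (shift≈q^-*ₛ j (shift k f))) (shift-shift j k f)

q^-+ : ∀ a b → q^ a *ₛ q^ b ≈ q^ (a + b)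
q^-+ a b = q^-*ₛ-shift b a 1ₛ

q^-≡ : ∀ {a b} → a ≡ b → q^ a ≈ q^ b
q^-≡ = shift-≡ 1ₛ

shift-below : ∀ k f n → n < k → shift k f n ≡ 0₃
shift-below (suc k) f zero    l       = refl
shift-below (suc k) f (suc n) (s≤s l) = shift-below k f n l

shift-above : ∀ k f d → shift k f (k + d) ≡ f d
shift-above zero    f d = refl
shift-above (suc k) f d = shift-above k f d

q^-≈[]-0ₛ : ∀ k {K} → K ≤ k → q^ k ≈[ K ] 0ₛ
q^-≈[]-0ₛ k K≤k n l = shift-below k 1ₛ n (≤-trans l K≤k)

-1ₛ*-1ₛ≈1ₛ : -1ₛ *ₛ -1ₛ ≈ 1ₛ
-1ₛ*-1ₛ≈1ₛ = ≈-trans (const-*ₛ 2₃ -1ₛ) λ { zero → refl ; (suc n) → refl }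

1ₛ+-1ₛ≈0ₛ : 1ₛ +ₛ -1ₛ ≈ 0ₛ
1ₛ+-1ₛ≈0ₛ zero    = refl
1ₛ+-1ₛ≈0ₛ (suc n) = refl

f+f+f≈0ₛ : ∀ f → f +ₛ f +ₛ f ≈ 0ₛ
f+f+f≈0ₛ f n = x⊕x⊕x≡0 (f n)

-1ₛ*[f+f]≈f : ∀ f → -1ₛ *ₛ (f +ₛ f) ≈ f
-1ₛ*[f+f]≈f f n = trans (const-*ₛ 2₃ (f +ₛ f) n) (2⊗[x⊕x]≡x (f n))

1±q^-≈[]-1ₛ : ∀ c k {K} → K ≤ k → 1ₛ +ₛ c ·ₛ q^ k ≈[ K ] 1ₛ
1±q^-≈[]-1ₛ c k K≤k n l = trans (cong (λ x → 1ₛ n ⊕ c ⊗ x) (q^-≈[]-0ₛ k K≤k n l)) (trans (cong (1ₛ n ⊕_) (⊗-zeroʳ c)) (⊕-identityʳ (1ₛ n)))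

1-q^-≈[]-1ₛ : ∀ k {K} → K ≤ k → 1-q^ k ≈[ K ] 1ₛ
1-q^-≈[]-1ₛ k K≤k = ≈[]-trans (≈⇒≈[] (+ₛ-cong (≈-refl {1ₛ}) (const-*ₛ 2₃ (q^ k)))) (1±q^-≈[]-1ₛ 2₃ k K≤k)

1+q^-≈[]-1ₛ : ∀ k {K} → K ≤ k → 1+q^ k ≈[ K ] 1ₛ
1+q^-≈[]-1ₛ = 1±q^-≈[]-1ₛ 1₃

∑ₛ : (ℕ → Series) → ℕ → Series
∑ₛ F zero    = 0ₛ
∑ₛ F (suc n) = ∑ₛ F n +ₛ F n

∑ₛ-cong : ∀ {F G} n → (∀ i → i < n → F i ≈ G i) → ∑ₛ F n ≈ ∑ₛ G n
∑ₛ-cong zero    p k = refl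
∑ₛ-cong (suc n) p k = cong₂ _⊕_ (∑ₛ-cong n (λ i l → p i (m≤n⇒m≤1+n l)) k) (p n ≤-refl k)

∑ₛ-cong[] : ∀ {F G K} n → (∀ i → i < n → F i ≈[ K ] G i) → ∑ₛ F n ≈[ K ] ∑ₛ G n
∑ₛ-cong[] zero    p k _ = refl
∑ₛ-cong[] (suc n) p k l = cong₂ _⊕_ (∑ₛ-cong[] n (λ i l′ → p i (m≤n⇒m≤1+n l′)) k l) (p n ≤-refl k l)

*ₛ-∑ₛ : ∀ f F n → f *ₛ ∑ₛ F n ≈ ∑ₛ (λ i → f *ₛ F i) n
*ₛ-∑ₛ f F zero      = *ₛ-zeroʳ f
*ₛ-∑ₛ f F (suc n) k = trans (*ₛ-distribˡ-+ₛ f (∑ₛ F n) (F n) k) (cong (_⊕ (f *ₛ F n) k) (*ₛ-∑ₛ f F n k))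

∑ₛ-split : ∀ F a b → ∑ₛ F (a + b) ≈ ∑ₛ F a +ₛ ∑ₛ (λ i → F (a + i)) b
∑ₛ-split F a zero    k = trans (cong (λ x → ∑ₛ F x k) (+-identityʳ a)) (sym (⊕-identityʳ _))
∑ₛ-split F a (suc b) k = begin
  ∑ₛ F (a + suc b) k                                          ≡⟨ cong (λ x → ∑ₛ F x k) (+-suc a b) ⟩
  ∑ₛ F (a + b) k ⊕ F (a + b) k                                ≡⟨ cong (_⊕ F (a + b) k) (∑ₛ-split F a b k) ⟩
  (∑ₛ F a k ⊕ ∑ₛ (λ i → F (a + i)) b k) ⊕ F (a + b) k         ≡⟨ ⊕-assoc (∑ₛ F a k) (∑ₛ (λ i → F (a + i)) b k) (F (a + b) k) ⟩
  ∑ₛ F a k ⊕ (∑ₛ (λ i → F (a + i)) b k ⊕ F (a + b) k)         ∎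
  where open ≡-Reasoning

∑ₛ-first : ∀ F n → ∑ₛ F (suc n) ≈ F 0 +ₛ ∑ₛ (λ i → F (suc i)) n
∑ₛ-first F n = ∑ₛ-split F 1 n

∑ₛ-reverse : ∀ F n → ∑ₛ (λ i → F (n ∸ suc i)) n ≈ ∑ₛ F n
∑ₛ-reverse F zero    k = refl
∑ₛ-reverse F (suc n) k = begin
  ∑ₛ (λ i → F (n ∸ i)) (suc n) k            ≡⟨ ∑ₛ-first (λ i → F (n ∸ i)) n k ⟩
  F n k ⊕ ∑ₛ (λ i → F (n ∸ suc i)) n k      ≡⟨ cong (F n k ⊕_) (∑ₛ-reverse F n k) ⟩
  F n k ⊕ ∑ₛ F n k                          ≡⟨ ⊕-comm (F n k) (∑ₛ F n k) ⟩
  ∑ₛ F (suc n) k                            ∎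
  where open ≡-Reasoning

∏ₛ : (ℕ → Series) → ℕ → Series
∏ₛ F zero    = 1ₛ
∏ₛ F (suc n) = ∏ₛ F n *ₛ F n

∏ₛ-cong : ∀ {F G} n → (∀ i → i < n → F i ≈ G i) → ∏ₛ F n ≈ ∏ₛ G n
∏ₛ-cong zero    p = ≈-refl
∏ₛ-cong (suc n) p = *ₛ-cong (∏ₛ-cong n (λ i l → p i (m≤n⇒m≤1+n l))) (p n ≤-refl)

*ₛ-interchange : ∀ a b c d → (a *ₛ b) *ₛ (c *ₛ d) ≈ (a *ₛ c) *ₛ (b *ₛ d)
*ₛ-interchange = solve 4 (λ a b c d → (a :* b) :* (c :* d) := (a :* c) :* (b :* d)) ≈-refl

∏ₛ-*ₛ : ∀ F G n → ∏ₛ (λ i → F i *ₛ G i) n ≈ ∏ₛ F n *ₛ ∏ₛ G n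
∏ₛ-*ₛ F G zero    = ≈-sym (*ₛ-identityˡ 1ₛ)
∏ₛ-*ₛ F G (suc n) = ≈-trans (*ₛ-cong (∏ₛ-*ₛ F G n) (≈-refl {F n *ₛ G n})) (*ₛ-interchange (∏ₛ F n) (∏ₛ G n) (F n) (G n))

∏ₛ-first : ∀ F n → ∏ₛ F (suc n) ≈ F 0 *ₛ ∏ₛ (λ i → F (suc i)) n
∏ₛ-first F zero    = *ₛ-comm 1ₛ (F 0)
∏ₛ-first F (suc n) = ≈-trans (*ₛ-cong (∏ₛ-first F n) (≈-refl {F (suc n)})) (*ₛ-assoc (F 0) _ _)

∏ₛ-constant-term : ∀ F n → (∀ i → F i 0 ≡ 1₃) → ∏ₛ F n 0 ≡ 1₃
∏ₛ-constant-term F zero    p = refl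
∏ₛ-constant-term F (suc n) p = cong₂ _⊗_ (∏ₛ-constant-term F n p) (p n)

∏ₛ-stable : ∀ F K m x → m ≤ x → (∀ i → m ≤ i → F i ≈[ K ] 1ₛ) → ∏ₛ F x ≈[ K ] ∏ₛ F m
∏ₛ-stable F K m x m≤x p with m≤n⇒∃[o]m+o≡n m≤x
... | d , refl = go d
  where
  go : ∀ d → ∏ₛ F (m + d) ≈[ K ] ∏ₛ F m
  go zero    n l = cong (λ x → ∏ₛ F x n) (+-identityʳ m)
  go (suc d) n l = begin
    ∏ₛ F (m + suc d) n                ≡⟨ cong (λ x → ∏ₛ F x n) (+-suc m d) ⟩
    (∏ₛ F (m + d) *ₛ F (m + d)) n     ≡⟨ *ₛ-cong[] {∏ₛ F (m + d)} (go d) (p (m + d) (m≤m+n m d)) n l ⟩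
    (∏ₛ F m *ₛ 1ₛ) n                  ≡⟨ *ₛ-identityʳ (∏ₛ F m) n ⟩
    ∏ₛ F m n                          ∎
    where open ≡-Reasoning

*ₛ-cancelˡ : ∀ f g h K → f 0 ≡ 1₃ → f *ₛ g ≈[ K ] f *ₛ h → g ≈[ K ] h
*ₛ-cancelˡ f g h K f₀≡1 fg≈fh = λ n l → go n l n ≤-refl
  where
  go : ∀ n → n < K → ∀ i → i ≤ n → g i ≡ h i
  go zero l zero z≤n = begin
    g 0             ≡⟨ *ₛ-identityˡ g 0 ⟨
    1₃ ⊗ g 0        ≡⟨ cong (_⊗ g 0) f₀≡1 ⟨
    f 0 ⊗ g 0       ≡⟨ fg≈fh 0 l ⟩
    f 0 ⊗ h 0       ≡⟨ cong (_⊗ h 0) f₀≡1 ⟩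
    h 0             ∎
    where open ≡-Reasoning
  go (suc n) l i i≤1+n with m≤n⇒m<n∨m≡n i≤1+n
  ... | inj₁ (s≤s i≤n) = go n (≤-trans (n≤1+n _) l) i i≤n
  ... | inj₂ refl      = trans (sym (⊗-identityʳ (g (suc n))))
      (trans (cong (g (suc n) ⊗_) (sym f₀≡1)) (trans (⊕-cancelˡ ((g *ₛ tail f) n) _ _ top-coefficient)
      (trans (cong (h (suc n) ⊗_) f₀≡1) (⊗-identityʳ (h (suc n))))))
    where
    open ≡-Reasoning
    lower : (g *ₛ tail f) n ≡ (h *ₛ tail f) n
    lower = *ₛ-local n g h (tail f) (tail f) (go n (≤-trans (n≤1+n _) l)) (λ _ _ → refl)
    top-coefficient : (g *ₛ tail f) n ⊕ g (suc n) ⊗ f 0 ≡ (g *ₛ tail f) n ⊕ h (suc n) ⊗ f 0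
    top-coefficient = begin
      (g *ₛ tail f) n ⊕ g (suc n) ⊗ f 0   ≡⟨ *ₛ-sucʳ n g f ⟨
      (g *ₛ f) (suc n)                    ≡⟨ *ₛ-comm g f (suc n) ⟩
      (f *ₛ g) (suc n)                    ≡⟨ fg≈fh (suc n) l ⟩
      (f *ₛ h) (suc n)                    ≡⟨ *ₛ-comm f h (suc n) ⟩
      (h *ₛ f) (suc n)                    ≡⟨ *ₛ-sucʳ n h f ⟩
      (h *ₛ tail f) n ⊕ h (suc n) ⊗ f 0   ≡⟨ cong (_⊕ h (suc n) ⊗ f 0) lower ⟨
      (g *ₛ tail f) n ⊕ h (suc n) ⊗ f 0   ∎

-- Gaussian binomial coefficients
qBinom : ℕ → ℕ → Series
qBinom zero    b       = 1ₛ
qBinom (suc a) zero    = 1ₛ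
qBinom (suc a) (suc b) = qBinom a (suc b) +ₛ q^ (suc a) *ₛ qBinom (suc a) b

qPoch : ℕ → Series
qPoch = ∏ₛ λ i → 1-q^ (suc i)

qPoch-constant-term : ∀ m → qPoch m 0 ≡ 1₃
qPoch-constant-term m = ∏ₛ-constant-term _ m λ i → refl

qBinom-1-suc : ∀ b → qBinom 1 (suc b) ≈ qBinom 1 b +ₛ q^ (suc b)
qBinom-1-suc zero    = +ₛ-cong (≈-refl {1ₛ}) (*ₛ-identityʳ (q^ 1))
qBinom-1-suc (suc b) = begin
  1ₛ +ₛ q^ 1 *ₛ qBinom 1 (suc b)                  ≈⟨ +ₛ-cong (≈-refl {1ₛ}) (*ₛ-cong (≈-refl {q^ 1}) (qBinom-1-suc b)) ⟩
  1ₛ +ₛ q^ 1 *ₛ (qBinom 1 b +ₛ q^ (suc b))        ≈⟨ solve 3 (λ x g y → con 1 :+ x :* (g :+ y) := (con 1 :+ x :* g) :+ x :* y)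
                                                               ≈-refl (q^ 1) (qBinom 1 b) (q^ (suc b)) ⟩
  (1ₛ +ₛ q^ 1 *ₛ qBinom 1 b) +ₛ q^ 1 *ₛ q^ (suc b) ≈⟨ +ₛ-cong (≈-refl {1ₛ +ₛ q^ 1 *ₛ qBinom 1 b}) (q^-+ 1 (suc b)) ⟩
  (1ₛ +ₛ q^ 1 *ₛ qBinom 1 b) +ₛ q^ (suc (suc b))   ∎
  where open ≈-Reasoning

qBinom-suc-1 : ∀ a → qBinom a 1 +ₛ q^ (suc a) ≈ q^ 1 *ₛ qBinom a 1 +ₛ 1ₛ
qBinom-suc-1 zero    = ≈-trans (+ₛ-comm 1ₛ (q^ 1)) (+ₛ-cong (≈-sym (*ₛ-identityʳ (q^ 1))) (≈-refl {1ₛ}))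
qBinom-suc-1 (suc a) = begin
  (qBinom a 1 +ₛ q^ (suc a) *ₛ 1ₛ) +ₛ q^ (suc (suc a))
    ≈⟨ +ₛ-cong (+ₛ-cong (≈-refl {qBinom a 1}) (*ₛ-identityʳ (q^ (suc a)))) (≈-sym (q^-+ 1 (suc a))) ⟩
  (qBinom a 1 +ₛ q^ (suc a)) +ₛ q^ 1 *ₛ q^ (suc a)
    ≈⟨ +ₛ-cong (qBinom-suc-1 a) (≈-refl {q^ 1 *ₛ q^ (suc a)}) ⟩
  (q^ 1 *ₛ qBinom a 1 +ₛ 1ₛ) +ₛ q^ 1 *ₛ q^ (suc a)
    ≈⟨ solve 3 (λ x g y → (x :* g :+ con 1) :+ x :* y := x :* (g :+ y :* con 1) :+ con 1) ≈-refl (q^ 1) (qBinom a 1) (q^ (suc a)) ⟩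
  q^ 1 *ₛ (qBinom a 1 +ₛ q^ (suc a) *ₛ 1ₛ) +ₛ 1ₛ
    ∎
  where open ≈-Reasoning

q^-+-swap : ∀ a b c d → a + b ≡ c + d → q^ a *ₛ q^ b ≈ q^ c *ₛ q^ d
q^-+-swap a b c d eq = ≈-trans (q^-+ a b) (≈-trans (q^-≡ eq) (≈-sym (q^-+ c d)))

qBinom-pascalʳ : ∀ a b → qBinom (suc a) (suc b) ≈ q^ (suc b) *ₛ qBinom a (suc b) +ₛ qBinom (suc a) b
qBinom-pascalʳ zero b =
  ≈-trans (qBinom-1-suc b) (≈-trans (+ₛ-comm (qBinom 1 b) (q^ (suc b)))
          (+ₛ-cong (≈-sym (*ₛ-identityʳ (q^ (suc b)))) (≈-refl {qBinom 1 b})))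
qBinom-pascalʳ (suc a) zero = begin
  qBinom (suc a) 1 +ₛ q^ (suc (suc a)) *ₛ 1ₛ  ≈⟨ +ₛ-cong (≈-refl {qBinom (suc a) 1}) (*ₛ-identityʳ _) ⟩
  qBinom (suc a) 1 +ₛ q^ (suc (suc a))        ≈⟨ qBinom-suc-1 (suc a) ⟩
  q^ 1 *ₛ qBinom (suc a) 1 +ₛ 1ₛ              ∎
  where open ≈-Reasoning
qBinom-pascalʳ (suc a) (suc b) = begin
  qBinom (suc a) (suc (suc b)) +ₛ Z *ₛ qBinom (suc (suc a)) (suc b)
    ≈⟨ +ₛ-cong (qBinom-pascalʳ a (suc b)) (*ₛ-cong (≈-refl {Z}) (qBinom-pascalʳ (suc a) b)) ⟩
  (Y *ₛ A +ₛ B) +ₛ Z *ₛ (W *ₛ B +ₛ C)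
    ≈⟨ solve 6 (λ y a b z w c → (y :* a :+ b) :+ z :* (w :* b :+ c) := (y :* a :+ b) :+ (z :* w) :* b :+ z :* c) ≈-refl Y A B Z W C ⟩
  (Y *ₛ A +ₛ B) +ₛ (Z *ₛ W) *ₛ B +ₛ Z *ₛ C
    ≈⟨ +ₛ-cong (+ₛ-cong (≈-refl {Y *ₛ A +ₛ B}) (*ₛ-cong (q^-+-swap (suc (suc a)) (suc b) (suc (suc b)) (suc a) exponents) (≈-refl {B})))
               (≈-refl {Z *ₛ C}) ⟩
  (Y *ₛ A +ₛ B) +ₛ (Y *ₛ X) *ₛ B +ₛ Z *ₛ C
    ≈⟨ solve 6 (λ y a b z x c → (y :* a :+ b) :+ (y :* x) :* b :+ z :* c := y :* (a :+ x :* b) :+ (b :+ z :* c)) ≈-refl Y A B Z X C ⟩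
  Y *ₛ (A +ₛ X *ₛ B) +ₛ (B +ₛ Z *ₛ C)
    ∎
  where
  open ≈-Reasoning
  A : Series
  A = qBinom a (suc (suc b))
  B : Series
  B = qBinom (suc a) (suc b)
  C : Series
  C = qBinom (suc (suc a)) b
  X : Series
  X = q^ (suc a)
  Y : Series
  Y = q^ (suc (suc b))
  Z : Series
  Z = q^ (suc (suc a))
  W : Series
  W = q^ (suc b)
  exponents : suc (suc a) + suc b ≡ suc (suc b) + suc a
  exponents = cong suc (trans (+-suc (suc a) b) (cong suc (+-comm (suc a) b)))

qBinom-*-qPoch : ∀ a b → qBinom a b *ₛ (qPoch a *ₛ qPoch b) ≈ qPoch (a + b)
qBinom-*-qPoch zero    b       = ≈-trans (*ₛ-identityˡ _) (*ₛ-identityˡ _)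
qBinom-*-qPoch (suc a) zero    =
  ≈-trans (*ₛ-identityˡ _) (≈-trans (*ₛ-identityʳ _) λ k → cong (λ x → qPoch x k) (sym (+-identityʳ (suc a))))
qBinom-*-qPoch (suc a) (suc b) = begin
  (qBinom a (suc b) +ₛ X *ₛ qBinom (suc a) b) *ₛ ((qPoch a *ₛ 1-q^ (suc a)) *ₛ (qPoch b *ₛ 1-q^ (suc b)))
    ≈⟨ solve 7 (λ g x h qa oa qb ob → (g :+ x :* h) :* ((qa :* oa) :* (qb :* ob))
                                    := (g :* (qa :* (qb :* ob))) :* oa :+ x :* (h :* ((qa :* oa) :* qb)) :* ob)
         ≈-refl (qBinom a (suc b)) X (qBinom (suc a) b) (qPoch a) (1-q^ (suc a)) (qPoch b) (1-q^ (suc b)) ⟩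
  (qBinom a (suc b) *ₛ (qPoch a *ₛ qPoch (suc b))) *ₛ 1-q^ (suc a)
    +ₛ X *ₛ (qBinom (suc a) b *ₛ (qPoch (suc a) *ₛ qPoch b)) *ₛ 1-q^ (suc b)
    ≈⟨ +ₛ-cong (*ₛ-cong (qBinom-*-qPoch a (suc b)) (≈-refl {1-q^ (suc a)}))
               (*ₛ-cong (*ₛ-cong (≈-refl {X}) (≈-trans (qBinom-*-qPoch (suc a) b) λ k → cong (λ x → qPoch x k) (sym (+-suc a b))))
                        (≈-refl {1-q^ (suc b)})) ⟩
  R *ₛ 1-q^ (suc a) +ₛ X *ₛ R *ₛ 1-q^ (suc b)
    ≈⟨ solve 4 (λ r x w n → r :* (con 1 :+ n :* x) :+ x :* r :* (con 1 :+ n :* w)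
                          := r :+ (con 1 :+ n) :* (x :* r) :+ r :* (n :* (x :* w))) ≈-refl R X (q^ (suc b)) -1ₛ ⟩
  R +ₛ (1ₛ +ₛ -1ₛ) *ₛ (X *ₛ R) +ₛ R *ₛ (-1ₛ *ₛ (X *ₛ q^ (suc b)))
    ≈⟨ +ₛ-cong (+ₛ-cong (≈-refl {R}) (≈-trans (*ₛ-cong 1ₛ+-1ₛ≈0ₛ (≈-refl {X *ₛ R})) (*ₛ-zeroˡ _)))
               (*ₛ-cong (≈-refl {R}) (*ₛ-cong (≈-refl { -1ₛ}) (q^-+ (suc a) (suc b)))) ⟩
  R +ₛ 0ₛ +ₛ R *ₛ (-1ₛ *ₛ q^ (suc (a + suc b)))
    ≈⟨ solve 2 (λ r y → r :+ con 0 :+ r :* y := r :* (con 1 :+ y)) ≈-refl R (-1ₛ *ₛ q^ (suc (a + suc b))) ⟩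
  R *ₛ 1-q^ (suc (a + suc b))
    ∎
  where
  open ≈-Reasoning
  X : Series
  X = q^ (suc a)
  R : Series
  R = qPoch (a + suc b)

-- A finite form of the Jacobi triple product
tri : ℕ → ℕ
tri zero    = 0
tri (suc k) = suc k + tri k

n≤tri[n] : ∀ k → k ≤ tri k
n≤tri[n] zero    = z≤n
n≤tri[n] (suc k) = m≤m+n (suc k) (tri k)

-- expo n a is the exponent of q in the a-th term of the n-th Jacobi sum below;
-- expo n (n + d) = tri d = expo n (n ∸ 1 ∸ d).
expo : ℕ → ℕ → ℕ
expo zero    j       = tri j
expo (suc n) zero    = tri n
expo (suc n) (suc j) = expo n j

compare-+ : ∀ j n → (∃ λ d → j ≡ n + d) ⊎ (∃ λ d → n ≡ suc (j + d))
compare-+ j       zero    = inj₁ (j , refl)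
compare-+ zero    (suc n) = inj₂ (n , refl)
compare-+ (suc j) (suc n) with compare-+ j n
... | inj₁ (d , p) = inj₁ (d , cong suc p)
... | inj₂ (d , p) = inj₂ (d , cong suc p)

expo-≥ : ∀ n d → expo n (n + d) ≡ tri d
expo-≥ zero    d = refl
expo-≥ (suc n) d = expo-≥ n d

expo-< : ∀ j d → expo (suc (j + d)) j ≡ tri d
expo-< zero    d = refl
expo-< (suc j) d = expo-< j d

expo-<′ : ∀ j d → expo (j + suc d) j ≡ tri d
expo-<′ j d = trans (cong (λ x → expo x j) (+-suc j d)) (expo-< j d)

expo-diagonal : ∀ j → expo j j ≡ 0
expo-diagonal j = trans (cong (expo j) (sym (+-identityʳ j))) (expo-≥ j 0)

expo-≥-suc : ∀ n d → expo n (suc (n + d)) ≡ tri (suc d)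
expo-≥-suc n d = trans (cong (expo n) (sym (+-suc n d))) (expo-≥ n (suc d))

expo-sucˡ : ∀ n j → expo (suc n) j + j ≡ n + expo n j
expo-sucˡ n j with compare-+ j (suc n)
... | inj₁ (d , refl) = trans (cong (_+ (suc n + d)) (expo-≥ (suc n) d))
      (trans (rearrange n d (tri d)) (cong (n +_) (sym (expo-≥-suc n d))))
  where
  rearrange : ∀ n d t → t + (suc n + d) ≡ n + (suc d + t)
  rearrange = solve-∀
... | inj₂ (zero , refl) = trans (cong (_+ j) (expo-< j 0))
      (trans (rearrange j) (cong ((j + 0) +_) (sym (trans (cong (λ x → expo x j) (+-identityʳ j)) (expo-diagonal j)))))
  where
  rearrange : ∀ j → tri 0 + j ≡ (j + 0) + 0
  rearrange = solve-∀
... | inj₂ (suc d , refl) = trans (cong (_+ j) (expo-< j (suc d)))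
      (trans (rearrange j d (tri d)) (cong ((j + suc d) +_) (sym (expo-<′ j d))))
  where
  rearrange : ∀ j d t → (suc d + t) + j ≡ (j + suc d) + t
  rearrange = solve-∀

expo-sucʳ : ∀ n j c → j + c ≡ n + n → expo n (suc j) + c ≡ suc n + expo n j
expo-sucʳ n j c j+c≡2n with compare-+ j n
... | inj₁ (d , refl) = trans (cong (_+ c) (expo-≥-suc n d)) (trans shuffle (cong (suc n +_) (sym (expo-≥ n d))))
  where
  d+c≡n : d + c ≡ n
  d+c≡n = +-cancelˡ-≡ n (d + c) n (trans (sym (+-assoc n d c)) j+c≡2n)
  rearrange : ∀ d c t → (suc d + t) + c ≡ suc (d + c) + t
  rearrange = solve-∀
  shuffle : tri (suc d) + c ≡ suc n + tri d
  shuffle = trans (rearrange d c (tri d)) (cong (λ x → suc x + tri d) d+c≡n)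
... | inj₂ (zero , refl) = trans (cong (_+ c) (trans (cong (λ x → expo x j) (+-identityʳ j)) (expo-diagonal j)))
      (trans c≡ (cong (suc (suc (j + 0)) +_) (sym (expo-< j 0))))
  where
  rearrange : ∀ j → suc (j + 0) + suc (j + 0) ≡ j + (suc (suc (j + 0)) + 0)
  rearrange = solve-∀
  c≡ : 0 + c ≡ suc (suc (j + 0)) + 0
  c≡ = +-cancelˡ-≡ j c (suc (suc (j + 0)) + 0) (trans j+c≡2n (rearrange j))
... | inj₂ (suc d , refl) = trans (cong (_+ c) (expo-<′ j d)) (trans shuffle (cong (suc (suc (j + suc d)) +_) (sym (expo-< j (suc d)))))
  where
  rearrange₁ : ∀ j d → suc (j + suc d) + suc (j + suc d) ≡ j + (j + 2 * d + 4)
  rearrange₁ = solve-∀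
  rearrange₂ : ∀ j d t → t + (j + 2 * d + 4) ≡ suc (suc (j + suc d)) + (suc d + t)
  rearrange₂ = solve-∀
  c≡ : c ≡ j + 2 * d + 4
  c≡ = +-cancelˡ-≡ j c (j + 2 * d + 4) (trans j+c≡2n (rearrange₁ j d))
  shuffle : tri d + c ≡ suc (suc (j + suc d)) + tri (suc d)
  shuffle = trans (cong (tri d +_) c≡) (rearrange₂ j d (tri d))

∑antidiagonal : (ℕ → ℕ → Series) → ℕ → Series
∑antidiagonal F zero    = F 0 0
∑antidiagonal F (suc m) = F 0 (suc m) +ₛ ∑antidiagonal (λ a b → F (suc a) b) m

∑antidiagonal-cong : ∀ m {F H : ℕ → ℕ → Series} → (∀ a b → a + b ≡ m → F a b ≈ H a b) →
                     ∑antidiagonal F m ≈ ∑antidiagonal H m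
∑antidiagonal-cong zero    p = p 0 0 refl
∑antidiagonal-cong (suc m) p = +ₛ-cong (p 0 (suc m) refl) (∑antidiagonal-cong m λ a b e → p (suc a) b (cong suc e))

∑antidiagonal-cong[] : ∀ m {K} {F H : ℕ → ℕ → Series} → (∀ a b → a + b ≡ m → F a b ≈[ K ] H a b) →
                       ∑antidiagonal F m ≈[ K ] ∑antidiagonal H m
∑antidiagonal-cong[] zero    p = p 0 0 refl
∑antidiagonal-cong[] (suc m) p = +ₛ-cong[] (p 0 (suc m) refl) (∑antidiagonal-cong[] m λ a b e → p (suc a) b (cong suc e))

∑antidiagonal-last : ∀ m F → ∑antidiagonal F (suc m) ≈ ∑antidiagonal (λ a b → F a (suc b)) m +ₛ F (suc m) 0
∑antidiagonal-last zero    F = ≈-refl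
∑antidiagonal-last (suc m) F =
  ≈-trans (+ₛ-cong (≈-refl {F 0 (suc (suc m))}) (∑antidiagonal-last m λ a b → F (suc a) b)) (≈-sym (+ₛ-assoc (F 0 (suc (suc m))) (∑antidiagonal (λ a b → F (suc a) (suc b)) m) (F (suc (suc m)) 0)))

*ₛ-∑antidiagonal : ∀ m f F → f *ₛ ∑antidiagonal F m ≈ ∑antidiagonal (λ a b → f *ₛ F a b) m
*ₛ-∑antidiagonal zero    f F = ≈-refl
*ₛ-∑antidiagonal (suc m) f F =
  ≈-trans (*ₛ-distribˡ-+ₛ f _ _) (+ₛ-cong (≈-refl {f *ₛ F 0 (suc m)}) (*ₛ-∑antidiagonal m f λ a b → F (suc a) b))

∑antidiagonal-+ₛ : ∀ m F H → ∑antidiagonal (λ a b → F a b +ₛ H a b) m ≈ ∑antidiagonal F m +ₛ ∑antidiagonal H m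
∑antidiagonal-+ₛ zero    F H = ≈-refl
∑antidiagonal-+ₛ (suc m) F H =
  ≈-trans (+ₛ-cong (≈-refl {F 0 (suc m) +ₛ H 0 (suc m)}) (∑antidiagonal-+ₛ m (λ a b → F (suc a) b) (λ a b → H (suc a) b)))
          (+ₛ-interchange (F 0 (suc m)) (H 0 (suc m)) (∑antidiagonal (λ a b → F (suc a) b) m) (∑antidiagonal (λ a b → H (suc a) b) m))

∑antidiagonal-const : ∀ m (f : ℕ → Series) → ∑antidiagonal (λ a b → f a) m ≈ ∑ₛ f (suc m)
∑antidiagonal-const zero    f = ≈-sym (+ₛ-identityˡ (f 0))
∑antidiagonal-const (suc m) f =
  ≈-trans (+ₛ-cong (≈-refl {f 0}) (∑antidiagonal-const m λ a → f (suc a))) (≈-sym (∑ₛ-first f (suc m)))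

qBinom⁻ : ℕ → ℕ → Series
qBinom⁻ zero    _       = 0ₛ
qBinom⁻ (suc x) zero    = 0ₛ
qBinom⁻ (suc x) (suc y) = qBinom x y

qBinom-zeroʳ : ∀ a → qBinom a 0 ≈ 1ₛ
qBinom-zeroʳ zero    = ≈-refl
qBinom-zeroʳ (suc a) = ≈-refl

qBinom-sucʳ : ∀ a b → qBinom a (suc b) ≈ q^ (suc b) *ₛ qBinom⁻ a (suc (suc b)) +ₛ qBinom a b
qBinom-sucʳ zero    b = ≈-sym (+ₛ-cong (*ₛ-zeroʳ (q^ (suc b))) (≈-refl {1ₛ}))
qBinom-sucʳ (suc a) b = qBinom-pascalʳ a b

qBinom-sucˡ : ∀ a b → qBinom (suc a) b ≈ q^ b *ₛ qBinom a b +ₛ qBinom⁻ (suc (suc a)) b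
qBinom-sucˡ a zero    = ≈-sym (≈-trans (+ₛ-identityʳ _) (≈-trans (*ₛ-identityˡ (qBinom a 0)) (qBinom-zeroʳ a)))
qBinom-sucˡ a (suc b) = qBinom-pascalʳ a b

qBinom-three-term : ∀ a b → qBinom (suc a) (suc b) ≈
  q^ (suc b) *ₛ qBinom⁻ a (suc (suc b)) +ₛ 1+q^ (suc (a + b)) *ₛ qBinom a b +ₛ q^ (suc a) *ₛ qBinom⁻ (suc (suc a)) b
qBinom-three-term a b = begin
  qBinom a (suc b) +ₛ X *ₛ qBinom (suc a) b
    ≈⟨ +ₛ-cong (qBinom-sucʳ a b) (*ₛ-cong (≈-refl {X}) (qBinom-sucˡ a b)) ⟩
  (Y *ₛ g₁ +ₛ g) +ₛ X *ₛ (q^ b *ₛ g +ₛ g₂)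
    ≈⟨ solve 6 (λ y g₁ g x w g₂ → (y :* g₁ :+ g) :+ x :* (w :* g :+ g₂) := y :* g₁ :+ (con 1 :+ x :* w) :* g :+ x :* g₂)
               ≈-refl Y g₁ g X (q^ b) g₂ ⟩
  Y *ₛ g₁ +ₛ (1ₛ +ₛ X *ₛ q^ b) *ₛ g +ₛ X *ₛ g₂
    ≈⟨ +ₛ-cong (+ₛ-cong (≈-refl {Y *ₛ g₁}) (*ₛ-cong (+ₛ-cong (≈-refl {1ₛ}) (q^-+ (suc a) b)) (≈-refl {g}))) (≈-refl {X *ₛ g₂}) ⟩
  Y *ₛ g₁ +ₛ 1+q^ (suc (a + b)) *ₛ g +ₛ X *ₛ g₂
    ∎
  where
  open ≈-Reasoning
  X : Series
  X = q^ (suc a)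
  Y : Series
  Y = q^ (suc b)
  g = qBinom a b
  g₁ : Series
  g₁ = qBinom⁻ a (suc (suc b))
  g₂ : Series
  g₂ = qBinom⁻ (suc (suc a)) b

jacobiTerm : ℕ → ℕ → ℕ → Series
jacobiTerm n a b = shift (expo n a) (qBinom a b)

jacobiSum : ℕ → Series
jacobiSum n = ∑antidiagonal (jacobiTerm n) (n + n)

shift-q^-*ₛ : ∀ k j f → shift k (q^ j *ₛ f) ≈ shift (k + j) f
shift-q^-*ₛ k j f = ≈-trans (shift-cong k (≈-sym (shift≈q^-*ₛ j f))) (shift-shift k j f)

shift-+ : ∀ a b f → shift (a + b) f ≈ q^ a *ₛ shift b f
shift-+ a b f = ≈-sym (q^-*ₛ-shift b a f)

jacobiTermˡ jacobiTermᵐ jacobiTermʳ : ℕ → ℕ → ℕ → Series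
jacobiTermˡ n a b = shift (expo n a) (q^ (suc b) *ₛ qBinom⁻ a (suc (suc b)))
jacobiTermᵐ n a b = shift (expo n a) (1+q^ (suc (a + b)) *ₛ qBinom a b)
jacobiTermʳ n a b = shift (expo n a) (q^ (suc a) *ₛ qBinom⁻ (suc (suc a)) b)

∑jacobiTermˡ : ∀ n → ∑antidiagonal (jacobiTermˡ n) (n + n) +ₛ q^ (suc n) *ₛ jacobiTerm n (n + n) 0 ≈ q^ (suc n) *ₛ jacobiSum n
∑jacobiTermˡ zero = +ₛ-cong (≈-trans (shift-cong 0 (*ₛ-zeroʳ (q^ 1))) (shift-0ₛ 0)) (≈-refl {q^ 1 *ₛ jacobiTerm 0 0 0})
∑jacobiTermˡ (suc n′) = begin
  (jacobiTermˡ n 0 (suc m′) +ₛ ∑antidiagonal (λ a b → jacobiTermˡ n (suc a) b) m′) +ₛ Y *ₛ jacobiTerm n (suc m′) 0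
    ≈⟨ +ₛ-cong (+ₛ-cong (≈-trans (shift-cong (expo n 0) (*ₛ-zeroʳ _)) (shift-0ₛ (expo n 0))) (∑antidiagonal-cong m′ shifted))
               (≈-refl {Y *ₛ jacobiTerm n (suc m′) 0}) ⟩
  (0ₛ +ₛ ∑antidiagonal (λ a b → Y *ₛ jacobiTerm n a (suc b)) m′) +ₛ Y *ₛ jacobiTerm n (suc m′) 0
    ≈⟨ +ₛ-cong (≈-sym (*ₛ-∑antidiagonal m′ Y λ a b → jacobiTerm n a (suc b))) (≈-refl {Y *ₛ jacobiTerm n (suc m′) 0}) ⟩
  Y *ₛ ∑antidiagonal (λ a b → jacobiTerm n a (suc b)) m′ +ₛ Y *ₛ jacobiTerm n (suc m′) 0
    ≈⟨ *ₛ-distribˡ-+ₛ Y _ _ ⟨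
  Y *ₛ (∑antidiagonal (λ a b → jacobiTerm n a (suc b)) m′ +ₛ jacobiTerm n (suc m′) 0)
    ≈⟨ *ₛ-cong (≈-refl {Y}) (∑antidiagonal-last m′ (jacobiTerm n)) ⟨
  Y *ₛ jacobiSum n
    ∎
  where
  open ≈-Reasoning
  n : ℕ
  n = suc n′
  m′ : ℕ
  m′ = n′ + suc n′
  Y : Series
  Y = q^ (suc n)
  shifted : ∀ a b → a + b ≡ m′ → jacobiTermˡ n (suc a) b ≈ Y *ₛ jacobiTerm n a (suc b)
  shifted a b a+b≡m′ =
    ≈-trans (shift-q^-*ₛ (expo n (suc a)) (suc b) (qBinom a (suc b)))
    (≈-trans (shift-≡ (qBinom a (suc b)) (expo-sucʳ n a (suc b) (trans (+-suc a b) (cong suc a+b≡m′))))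
             (shift-+ (suc n) (expo n a) (qBinom a (suc b))))

∑jacobiTermʳ : ∀ n → ∑antidiagonal (jacobiTermʳ n) (n + n) +ₛ q^ n *ₛ jacobiTerm n 0 (n + n) ≈ q^ n *ₛ jacobiSum n
∑jacobiTermʳ zero = +ₛ-cong (≈-trans (shift-cong 0 (*ₛ-zeroʳ (q^ 1))) (shift-0ₛ 0)) (≈-refl {q^ 0 *ₛ jacobiTerm 0 0 0})
∑jacobiTermʳ (suc n′) = begin
  ∑antidiagonal (jacobiTermʳ n) (suc m′) +ₛ X *ₛ jacobiTerm n 0 (suc m′)
    ≈⟨ +ₛ-cong (∑antidiagonal-last m′ (jacobiTermʳ n)) (≈-refl {X *ₛ jacobiTerm n 0 (suc m′)}) ⟩
  (∑antidiagonal (λ a b → jacobiTermʳ n a (suc b)) m′ +ₛ jacobiTermʳ n (suc m′) 0) +ₛ X *ₛ jacobiTerm n 0 (suc m′)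
    ≈⟨ +ₛ-cong (+ₛ-cong (∑antidiagonal-cong m′ (λ a b _ → shifted a b))
                        (≈-trans (shift-cong (expo n (suc m′)) (*ₛ-zeroʳ _)) (shift-0ₛ (expo n (suc m′)))))
               (≈-refl {X *ₛ jacobiTerm n 0 (suc m′)}) ⟩
  (∑antidiagonal (λ a b → X *ₛ jacobiTerm n (suc a) b) m′ +ₛ 0ₛ) +ₛ X *ₛ jacobiTerm n 0 (suc m′)
    ≈⟨ +ₛ-cong (≈-trans (+ₛ-identityʳ _) (≈-sym (*ₛ-∑antidiagonal m′ X λ a b → jacobiTerm n (suc a) b)))
               (≈-refl {X *ₛ jacobiTerm n 0 (suc m′)}) ⟩
  X *ₛ ∑antidiagonal (λ a b → jacobiTerm n (suc a) b) m′ +ₛ X *ₛ jacobiTerm n 0 (suc m′)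
    ≈⟨ +ₛ-comm (X *ₛ ∑antidiagonal (λ a b → jacobiTerm n (suc a) b) m′) (X *ₛ jacobiTerm n 0 (suc m′)) ⟩
  X *ₛ jacobiTerm n 0 (suc m′) +ₛ X *ₛ ∑antidiagonal (λ a b → jacobiTerm n (suc a) b) m′
    ≈⟨ *ₛ-distribˡ-+ₛ X _ _ ⟨
  X *ₛ jacobiSum n
    ∎
  where
  open ≈-Reasoning
  n : ℕ
  n = suc n′
  m′ : ℕ
  m′ = n′ + suc n′
  X : Series
  X = q^ n
  shifted : ∀ a b → jacobiTermʳ n a (suc b) ≈ X *ₛ jacobiTerm n (suc a) b
  shifted a b =
    ≈-trans (shift-q^-*ₛ (expo n a) (suc a) (qBinom (suc a) b))
    (≈-trans (shift-≡ (qBinom (suc a) b) (expo-sucˡ n (suc a)))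
             (shift-+ n (expo n (suc a)) (qBinom (suc a) b)))

∑jacobiTermᵐ : ∀ n → ∑antidiagonal (jacobiTermᵐ n) (n + n) ≈ 1+q^ (suc (n + n)) *ₛ jacobiSum n
∑jacobiTermᵐ n = ≈-trans (∑antidiagonal-cong (n + n) middle) (≈-sym (*ₛ-∑antidiagonal (n + n) _ (jacobiTerm n)))
  where
  middle : ∀ a b → a + b ≡ n + n → jacobiTermᵐ n a b ≈ 1+q^ (suc (n + n)) *ₛ jacobiTerm n a b
  middle a b a+b≡2n = ≈-trans (shift-cong (expo n a) (*ₛ-cong (+ₛ-cong (≈-refl {1ₛ}) (q^-≡ (cong suc a+b≡2n))) (≈-refl {qBinom a b})))
                              (≈-sym (shift-*ₛʳ (expo n a) _ (qBinom a b)))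

∑jacobiTerm-suc-suc : ∀ n → ∑antidiagonal (λ a b → jacobiTerm (suc n) (suc a) b) (suc (n + n)) ≈
  (∑antidiagonal (jacobiTermˡ n) (n + n) +ₛ ∑antidiagonal (jacobiTermᵐ n) (n + n) +ₛ ∑antidiagonal (jacobiTermʳ n) (n + n))
    +ₛ jacobiTerm (suc n) (suc (suc (n + n))) 0
∑jacobiTerm-suc-suc n =
  ≈-trans (∑antidiagonal-last (n + n) λ a b → jacobiTerm (suc n) (suc a) b)
  (+ₛ-cong (≈-trans (∑antidiagonal-cong (n + n) λ a b _ →
                       ≈-trans (shift-cong (expo n a) (qBinom-three-term a b))
                               (≈-trans (shift-+ₛ (expo n a) _ _) (+ₛ-cong (shift-+ₛ (expo n a) _ _) (≈-refl {jacobiTermʳ n a b}))))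
                    (≈-trans (∑antidiagonal-+ₛ (n + n) _ _) (+ₛ-cong (∑antidiagonal-+ₛ (n + n) _ _) (≈-refl {∑antidiagonal (jacobiTermʳ n) (n + n)}))))
           (≈-refl {jacobiTerm (suc n) (suc (suc (n + n))) 0}))

jacobiTerm-first : ∀ n → jacobiTerm (suc n) 0 (suc (suc (n + n))) ≈ q^ n *ₛ jacobiTerm n 0 (n + n)
jacobiTerm-first n = ≈-trans (shift-≡ 1ₛ (trans (sym (+-identityʳ (tri n))) (expo-sucˡ n 0))) (shift-+ n (expo n 0) 1ₛ)

jacobiTerm-last : ∀ n → jacobiTerm (suc n) (suc (suc (n + n))) 0 ≈ q^ (suc n) *ₛ jacobiTerm n (n + n) 0
jacobiTerm-last n =
  ≈-trans (shift-≡ 1ₛ (trans (sym (+-identityʳ _)) (expo-sucʳ n (n + n) 0 (+-identityʳ (n + n)))))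
          (≈-trans (shift-+ (suc n) (expo n (n + n)) 1ₛ)
                   (*ₛ-cong (≈-refl {q^ (suc n)}) (shift-cong (expo n (n + n)) (≈-sym (qBinom-zeroʳ (n + n))))))

jacobiSum-suc : ∀ n → jacobiSum (suc n) ≈ (1+q^ n *ₛ 1+q^ (suc n)) *ₛ jacobiSum n
jacobiSum-suc n = begin
  jacobiSum (suc n)
    ≈⟨ (λ k → cong (λ x → ∑antidiagonal (jacobiTerm (suc n)) (suc x) k) (+-suc n n)) ⟩
  jacobiTerm (suc n) 0 (suc (suc (n + n))) +ₛ ∑antidiagonal (λ a b → jacobiTerm (suc n) (suc a) b) (suc (n + n))
    ≈⟨ +ₛ-cong (jacobiTerm-first n) (≈-trans (∑jacobiTerm-suc-suc n)
                 (+ₛ-cong (+ₛ-cong (+ₛ-cong (≈-refl {Aˡ}) (∑jacobiTermᵐ n)) (≈-refl {Aʳ})) (jacobiTerm-last n))) ⟩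
  X *ₛ Cᶠ +ₛ ((Aˡ +ₛ P *ₛ S +ₛ Aʳ) +ₛ Y *ₛ Cˡ)
    ≈⟨ solve 8 (λ x cf a1 p s a3 y cl → x :* cf :+ ((a1 :+ p :* s :+ a3) :+ y :* cl) := (a1 :+ y :* cl) :+ p :* s :+ (a3 :+ x :* cf))
               ≈-refl X Cᶠ Aˡ P S Aʳ Y Cˡ ⟩
  (Aˡ +ₛ Y *ₛ Cˡ) +ₛ P *ₛ S +ₛ (Aʳ +ₛ X *ₛ Cᶠ)
    ≈⟨ +ₛ-cong (+ₛ-cong (∑jacobiTermˡ n) (*ₛ-cong (+ₛ-cong (≈-refl {1ₛ}) q^[2n+1]) (≈-refl {S}))) (∑jacobiTermʳ n) ⟩
  Y *ₛ S +ₛ (1ₛ +ₛ X *ₛ Y) *ₛ S +ₛ X *ₛ S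
    ≈⟨ solve 3 (λ y x s → y :* s :+ (con 1 :+ x :* y) :* s :+ x :* s := (con 1 :+ x) :* (con 1 :+ y) :* s) ≈-refl Y X S ⟩
  (1+q^ n *ₛ 1+q^ (suc n)) *ₛ S
    ∎
  where
  open ≈-Reasoning
  X Y P S Cᶠ Cˡ Aˡ Aʳ : Series
  X  = q^ n
  Y  = q^ (suc n)
  P  = 1+q^ (suc (n + n))
  S  = jacobiSum n
  Cᶠ = jacobiTerm n 0 (n + n)
  Cˡ = jacobiTerm n (n + n) 0
  Aˡ = ∑antidiagonal (jacobiTermˡ n) (n + n)
  Aʳ = ∑antidiagonal (jacobiTermʳ n) (n + n)
  q^[2n+1] : q^ (suc (n + n)) ≈ X *ₛ Y
  q^[2n+1] = ≈-sym (≈-trans (q^-+ n (suc n)) (q^-≡ (+-suc n n)))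

-- Gauss's identity for ψ
qPoch⁺ : ℕ → Series
qPoch⁺ = ∏ₛ λ i → 1+q^ (suc i)

∏ₛ-stable′ : ∀ (F : ℕ → Series) → (∀ i {K} → K ≤ suc i → F i ≈[ K ] 1ₛ) →
             ∀ K x y → K ≤ suc x → K ≤ suc y → ∏ₛ F x ≈[ K ] ∏ₛ F y
∏ₛ-stable′ F F≈1 zero    x y _ _ n ()
∏ₛ-stable′ F F≈1 (suc K) x y K≤x K≤y =
  ≈[]-trans (∏ₛ-stable F (suc K) K x (≤-pred K≤x) λ i l → F≈1 i (s≤s l))
            (≈[]-sym (∏ₛ-stable F (suc K) K y (≤-pred K≤y) λ i l → F≈1 i (s≤s l)))

qPoch-stable : ∀ K x y → K ≤ suc x → K ≤ suc y → qPoch x ≈[ K ] qPoch y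
qPoch-stable = ∏ₛ-stable′ _ λ i → 1-q^-≈[]-1ₛ (suc i)

qPoch⁺-stable : ∀ K x y → K ≤ suc x → K ≤ suc y → qPoch⁺ x ≈[ K ] qPoch⁺ y
qPoch⁺-stable = ∏ₛ-stable′ _ λ i → 1+q^-≈[]-1ₛ (suc i)

qBinom-*-qPoch≈[]1ₛ : ∀ a b K → K ≤ suc a → K ≤ suc b → qBinom a b *ₛ qPoch (a + b) ≈[ K ] 1ₛ
qBinom-*-qPoch≈[]1ₛ a b K K≤a K≤b = *ₛ-cancelˡ R (qBinom a b *ₛ R) 1ₛ K (qPoch-constant-term (a + b)) R*GR≈[]R
  where
  R : Series
  R = qPoch (a + b)
  R*GR≈[]R : R *ₛ (qBinom a b *ₛ R) ≈[ K ] R *ₛ 1ₛ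
  R*GR≈[]R =
    ≈[]-trans (≈⇒≈[] (solve 2 (λ r g → r :* (g :* r) := g :* (r :* r)) ≈-refl R (qBinom a b)))
    (≈[]-trans (*ₛ-cong[] {qBinom a b} ≈[]-refl
                  (*ₛ-cong[] (qPoch-stable K (a + b) a (≤-trans K≤a (s≤s (m≤m+n a b))) K≤a)
                             (qPoch-stable K (a + b) b (≤-trans K≤b (s≤s (m≤n+m b a))) K≤b)))
               (≈⇒≈[] (≈-trans (qBinom-*-qPoch a b) (≈-sym (*ₛ-identityʳ R)))))

jacobiTerm-*-qPoch≈[]q^ : ∀ n a b K → a + b ≡ n + n → K ≤ suc a → K ≤ suc b → n ≤ expo n a + K →
                          jacobiTerm n a b *ₛ qPoch (n + n) ≈[ n ] q^ (expo n a)
jacobiTerm-*-qPoch≈[]q^ n a b K a+b≡2n K≤a K≤b n≤ =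
  ≈[]-trans (≈⇒≈[] (shift-*ₛˡ (expo n a) (qBinom a b) (qPoch (n + n))))
            (≈[]-weaken n≤ (shift-cong[] (expo n a)
              (≈[]-trans (≈⇒≈[] λ k → cong (λ x → (qBinom a b *ₛ qPoch x) k) (sym a+b≡2n))
                         (qBinom-*-qPoch≈[]1ₛ a b K K≤a K≤b))))

jacobiTerm-limit : ∀ n a b → a + b ≡ n + n → jacobiTerm n a b *ₛ qPoch (n + n) ≈[ n ] q^ (expo n a)
jacobiTerm-limit n a b a+b≡2n with compare-+ a n
... | inj₁ (d , refl) = jacobiTerm-*-qPoch≈[]q^ n (n + d) b (suc b) a+b≡2n (s≤s (≤-trans b≤n (m≤m+n n d))) ≤-refl n≤
  where
  d+b≡n : d + b ≡ n
  d+b≡n = +-cancelˡ-≡ n (d + b) n (trans (sym (+-assoc n d b)) a+b≡2n)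
  b≤n : b ≤ n
  b≤n = subst (b ≤_) d+b≡n (m≤n+m b d)
  n≤ : n ≤ expo n (n + d) + suc b
  n≤ = subst (λ x → n ≤ x + suc b) (sym (expo-≥ n d))
         (subst (_≤ tri d + suc b) d+b≡n (≤-trans (+-monoˡ-≤ b (n≤tri[n] d)) (+-monoʳ-≤ (tri d) (n≤1+n b))))
... | inj₂ (d , refl) = jacobiTerm-*-qPoch≈[]q^ (suc (a + d)) a b (suc a) a+b≡2n ≤-refl (s≤s a≤b) n≤
  where
  rearrange₁ : ∀ a d → suc (a + d) + suc (a + d) ≡ a + suc (d + suc (a + d))
  rearrange₁ = solve-∀
  rearrange₂ : ∀ a d → d + suc a ≡ suc (a + d)
  rearrange₂ = solve-∀
  b≡ : b ≡ suc (d + suc (a + d))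
  b≡ = +-cancelˡ-≡ a b _ (trans a+b≡2n (rearrange₁ a d))
  a≤b : a ≤ b
  a≤b = subst (a ≤_) (sym b≡) (≤-trans (m≤m+n a d) (≤-trans (n≤1+n (a + d)) (≤-trans (m≤n+m (suc (a + d)) d) (n≤1+n _))))
  n≤ : suc (a + d) ≤ expo (suc (a + d)) a + suc a
  n≤ = subst (λ x → suc (a + d) ≤ x + suc a) (sym (expo-< a d))
         (subst (_≤ tri d + suc a) (rearrange₂ a d) (+-monoˡ-≤ (suc a) (n≤tri[n] d)))

ψ-partial : ℕ → Series
ψ-partial = ∑ₛ λ k → q^ (tri k)

ψ : Series
ψ m = ψ-partial (suc m) m

∑ₛ-0ₛ : ∀ n → ∑ₛ (λ _ → 0ₛ) n ≈ 0ₛ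
∑ₛ-0ₛ zero    = ≈-refl
∑ₛ-0ₛ (suc n) = ≈-trans (+ₛ-cong (∑ₛ-0ₛ n) (≈-refl {0ₛ})) (+ₛ-identityʳ 0ₛ)

ψ-partial-stable : ∀ K L → K ≤ L → ψ-partial L ≈[ K ] ψ-partial K
ψ-partial-stable K L K≤L with m≤n⇒∃[o]m+o≡n K≤L
... | d , refl =
  ≈[]-trans (≈⇒≈[] (∑ₛ-split (λ k → q^ (tri k)) K d))
  (≈[]-trans (+ₛ-cong[] {ψ-partial K} ≈[]-refl
               (≈[]-trans (∑ₛ-cong[] d λ i _ → q^-≈[]-0ₛ (tri (K + i)) (≤-trans (m≤m+n K i) (n≤tri[n] (K + i))))
                          (≈⇒≈[] (∑ₛ-0ₛ d))))
             (≈⇒≈[] (+ₛ-identityʳ (ψ-partial K))))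

ψ≈[]ψ-partial : ∀ K → ψ ≈[ K ] ψ-partial K
ψ≈[]ψ-partial K m m<K = sym (ψ-partial-stable (suc m) K m<K m ≤-refl)

∑q^expo : ∀ n → ∑ₛ (λ a → q^ (expo n a)) (suc (n + n)) ≈ ψ-partial n +ₛ ψ-partial (suc n)
∑q^expo n = ≈-trans (λ k → cong (λ x → ∑ₛ g x k) (sym (+-suc n n)))
            (≈-trans (∑ₛ-split g n (suc n))
            (+ₛ-cong (≈-trans (∑ₛ-cong n below) (∑ₛ-reverse (λ k → q^ (tri k)) n))
                     (∑ₛ-cong (suc n) λ i _ → q^-≡ (expo-≥ n i))))
  where
  g : ℕ → Series
  g a = q^ (expo n a)
  below : ∀ i → i < n → g i ≈ q^ (tri (n ∸ suc i))
  below i i<n with m≤n⇒∃[o]m+o≡n i<n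
  ... | d , refl = q^-≡ (trans (expo-< i d) (cong tri (sym (m+n∸m≡n i d))))

jacobiSum-*-qPoch≈[]ψ+ψ : ∀ n → jacobiSum n *ₛ qPoch (n + n) ≈[ n ] ψ +ₛ ψ
jacobiSum-*-qPoch≈[]ψ+ψ n =
  ≈[]-trans (≈⇒≈[] (≈-trans (*ₛ-comm (jacobiSum n) (qPoch (n + n))) (*ₛ-∑antidiagonal (n + n) (qPoch (n + n)) (jacobiTerm n))))
  (≈[]-trans (∑antidiagonal-cong[] (n + n) λ a b a+b≡2n →
               ≈[]-trans (≈⇒≈[] (*ₛ-comm (qPoch (n + n)) (jacobiTerm n a b))) (jacobiTerm-limit n a b a+b≡2n))
  (≈[]-trans (≈⇒≈[] (≈-trans (∑antidiagonal-const (n + n) λ a → q^ (expo n a))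
                    (≈-trans (∑q^expo n) (+ₛ-comm (ψ-partial n) (ψ-partial (suc n))))))
             (+ₛ-cong[] {ψ-partial (suc n)} {ψ} {ψ-partial n} {ψ}
                 (≈[]-trans (ψ-partial-stable n (suc n) (n≤1+n n)) (≈[]-sym (ψ≈[]ψ-partial n)))
                 (≈[]-sym (ψ≈[]ψ-partial n)))))

jacobiSum≈∏ : ∀ n → jacobiSum n ≈ ∏ₛ (λ i → 1+q^ i *ₛ 1+q^ (suc i)) n
jacobiSum≈∏ zero    = ≈-refl
jacobiSum≈∏ (suc n) =
  ≈-trans (jacobiSum-suc n) (≈-trans (*ₛ-comm _ _) (*ₛ-cong (jacobiSum≈∏ n) (≈-refl {1+q^ n *ₛ 1+q^ (suc n)})))

1+q^0≈-1ₛ : 1+q^ 0 ≈ -1ₛ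
1+q^0≈-1ₛ zero    = refl
1+q^0≈-1ₛ (suc k) = refl

jacobiSum≈-qPoch⁺-qPoch⁺ : ∀ n → jacobiSum (suc n) ≈ -1ₛ *ₛ (qPoch⁺ n *ₛ qPoch⁺ (suc n))
jacobiSum≈-qPoch⁺-qPoch⁺ n =
  ≈-trans (jacobiSum≈∏ (suc n))
  (≈-trans (∏ₛ-*ₛ 1+q^_ (λ i → 1+q^ (suc i)) (suc n))
  (≈-trans (*ₛ-cong (≈-trans (∏ₛ-first 1+q^_ n) (*ₛ-cong 1+q^0≈-1ₛ (≈-refl {qPoch⁺ n}))) (≈-refl {qPoch⁺ (suc n)}))
           (*ₛ-assoc -1ₛ (qPoch⁺ n) (qPoch⁺ (suc n)))))

ψ≈[]qPoch⁺²*qPoch : ∀ n M → n ≤ M → ψ ≈[ n ] (qPoch⁺ M *ₛ qPoch⁺ M) *ₛ qPoch M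
ψ≈[]qPoch⁺²*qPoch zero     M _ _ ()
ψ≈[]qPoch⁺²*qPoch (suc n′) M n≤M = ≈[]-sym (≈[]-trans truncate (≈[]-trans (≈⇒≈[] regroup)
  (≈[]-trans (*ₛ-cong[] { -1ₛ} ≈[]-refl (jacobiSum-*-qPoch≈[]ψ+ψ n)) (≈⇒≈[] (-1ₛ*[f+f]≈f ψ)))))
  where
  n : ℕ
  n = suc n′
  n≤1+M : n ≤ suc M
  n≤1+M = ≤-trans n≤M (n≤1+n M)
  truncate : (qPoch⁺ M *ₛ qPoch⁺ M) *ₛ qPoch M ≈[ n ] (qPoch⁺ n′ *ₛ qPoch⁺ n) *ₛ qPoch (n + n)
  truncate = *ₛ-cong[] (*ₛ-cong[] (qPoch⁺-stable n M n′ n≤1+M ≤-refl) (qPoch⁺-stable n M n n≤1+M (n≤1+n n)))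
                       (qPoch-stable n M (n + n) n≤1+M (s≤s (≤-trans (n≤1+n n′) (m≤m+n n n))))
  regroup : (qPoch⁺ n′ *ₛ qPoch⁺ n) *ₛ qPoch (n + n) ≈ -1ₛ *ₛ (jacobiSum n *ₛ qPoch (n + n))
  regroup = ≈-sym (≈-trans (*ₛ-cong (≈-refl { -1ₛ}) (*ₛ-cong (jacobiSum≈-qPoch⁺-qPoch⁺ n′) (≈-refl {qPoch (n + n)})))
    (≈-trans (solve 4 (λ m a b q → m :* ((m :* (a :* b)) :* q) := (m :* m) :* ((a :* b) :* q)) ≈-refl -1ₛ (qPoch⁺ n′) (qPoch⁺ n) (qPoch (n + n)))
    (≈-trans (*ₛ-cong -1ₛ*-1ₛ≈1ₛ (≈-refl {(qPoch⁺ n′ *ₛ qPoch⁺ n) *ₛ qPoch (n + n)})) (*ₛ-identityˡ _))))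

if-zero : ℕ → Series → Series → Series
if-zero zero    f g = f
if-zero (suc _) f g = g

if-zero-≡0 : ∀ {r} f g → r ≡ 0 → if-zero r f g ≈ f
if-zero-≡0 f g refl = ≈-refl

if-zero-≡suc : ∀ {r k} f g → r ≡ suc k → if-zero r f g ≈ g
if-zero-≡suc f g refl = ≈-refl

evenFactor oddFactor : ℕ → Series
evenFactor s = if-zero (s % 2) (1-q^ s) 1ₛ
oddFactor  s = if-zero (s % 2) 1ₛ (1-q^ s)

evenPoch oddPoch : ℕ → Series
evenPoch = ∏ₛ λ i → evenFactor (suc i)
oddPoch  = ∏ₛ λ i → oddFactor (suc i)

1-q^≈odd*even : ∀ s → 1-q^ s ≈ oddFactor s *ₛ evenFactor s
1-q^≈odd*even s with s % 2
... | zero  = ≈-sym (*ₛ-identityˡ _)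
... | suc _ = ≈-sym (*ₛ-identityʳ _)

qPoch≈oddPoch*evenPoch : ∀ x → qPoch x ≈ oddPoch x *ₛ evenPoch x
qPoch≈oddPoch*evenPoch x = ≈-trans (∏ₛ-cong x λ i _ → 1-q^≈odd*even (suc i)) (∏ₛ-*ₛ _ _ x)

[2M+1]%2≡1 : ∀ M → suc (M + M) % 2 ≡ 1
[2M+1]%2≡1 M = trans (cong (_% 2) (2M+1≡ M)) ([m+kn]%n≡m%n 1 M 2)
  where
  2M+1≡ : ∀ M → suc (M + M) ≡ 1 + M * 2
  2M+1≡ = solve-∀

[2M+2]%2≡0 : ∀ M → suc (suc (M + M)) % 2 ≡ 0
[2M+2]%2≡0 M = trans (cong (_% 2) (2M+2≡ M)) ([m+kn]%n≡m%n 0 (suc M) 2)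
  where
  2M+2≡ : ∀ M → suc (suc (M + M)) ≡ 0 + suc M * 2
  2M+2≡ = solve-∀

1+q^-*-1-q^ : ∀ k → 1+q^ k *ₛ 1-q^ k ≈ 1-q^ (k + k)
1+q^-*-1-q^ k =
  ≈-trans (solve 2 (λ x m → (con 1 :+ x) :* (con 1 :+ m :* x) := con 1 :+ (con 1 :+ m) :* x :+ m :* (x :* x)) ≈-refl (q^ k) -1ₛ)
  (≈-trans (+ₛ-cong (+ₛ-cong (≈-refl {1ₛ}) (≈-trans (*ₛ-cong 1ₛ+-1ₛ≈0ₛ (≈-refl {q^ k})) (*ₛ-zeroˡ _)))
                    (*ₛ-cong (≈-refl { -1ₛ}) (q^-+ k k)))
           (+ₛ-cong (+ₛ-identityʳ 1ₛ) (≈-refl { -1ₛ *ₛ q^ (k + k)})))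

evenPoch-double : ∀ M → evenPoch (M + M) ≈ qPoch⁺ M *ₛ qPoch M
evenPoch-double zero    = ≈-sym (*ₛ-identityˡ 1ₛ)
evenPoch-double (suc M) = begin
  evenPoch (suc M + suc M)
    ≈⟨ (λ k → cong (λ x → evenPoch x k) (cong suc (+-suc M M))) ⟩
  (evenPoch (M + M) *ₛ evenFactor (suc (M + M))) *ₛ evenFactor (suc (suc (M + M)))
    ≈⟨ *ₛ-cong (*ₛ-cong (evenPoch-double M) (if-zero-≡suc (1-q^ (suc (M + M))) 1ₛ ([2M+1]%2≡1 M)))
               (if-zero-≡0 (1-q^ (suc (suc (M + M)))) 1ₛ ([2M+2]%2≡0 M)) ⟩
  ((qPoch⁺ M *ₛ qPoch M) *ₛ 1ₛ) *ₛ 1-q^ (suc (suc (M + M)))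
    ≈⟨ *ₛ-cong (*ₛ-identityʳ _) (≈-sym (≈-trans (1+q^-*-1-q^ (suc M)) (1-q^-≡ (cong suc (+-suc M M))))) ⟩
  (qPoch⁺ M *ₛ qPoch M) *ₛ (1+q^ (suc M) *ₛ 1-q^ (suc M))
    ≈⟨ *ₛ-interchange (qPoch⁺ M) (qPoch M) (1+q^ (suc M)) (1-q^ (suc M)) ⟩
  qPoch⁺ (suc M) *ₛ qPoch (suc M)
    ∎
  where
  open ≈-Reasoning
  1-q^-≡ : ∀ {a b} → a ≡ b → 1-q^ a ≈ 1-q^ b
  1-q^-≡ refl = ≈-refl

euler : ∀ M → qPoch⁺ M *ₛ oddPoch (M + M) ≈[ suc M ] 1ₛ
euler M = *ₛ-cancelˡ (qPoch M) (qPoch⁺ M *ₛ oddPoch (M + M)) 1ₛ (suc M) (qPoch-constant-term M)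
  (≈[]-trans (≈⇒≈[] (≈-trans (solve 3 (λ q p o → q :* (p :* o) := o :* (p :* q)) ≈-refl (qPoch M) (qPoch⁺ M) (oddPoch (M + M)))
                   (≈-trans (*ₛ-cong (≈-refl {oddPoch (M + M)}) (≈-sym (evenPoch-double M)))
                            (≈-sym (qPoch≈oddPoch*evenPoch (M + M))))))
  (≈[]-trans (qPoch-stable (suc M) (M + M) M (s≤s (m≤m+n M M)) ≤-refl) (≈⇒≈[] (≈-sym (*ₛ-identityʳ (qPoch M))))))

oddPoch-stable : ∀ K x → K ≤ x → oddPoch x ≈[ suc K ] oddPoch K
oddPoch-stable K x K≤x = ∏ₛ-stable _ (suc K) K x K≤x λ i K≤i → factor (suc i) (s≤s K≤i)
  where
  factor : ∀ s → suc K ≤ s → oddFactor s ≈[ suc K ] 1ₛ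
  factor s K<s with s % 2
  ... | zero  = ≈[]-refl
  ... | suc _ = 1-q^-≈[]-1ₛ s K<s

evenPoch-stable : ∀ K x → K ≤ x → evenPoch x ≈[ suc K ] evenPoch K
evenPoch-stable K x K≤x = ∏ₛ-stable _ (suc K) K x K≤x λ i K≤i → factor (suc i) (s≤s K≤i)
  where
  factor : ∀ s → suc K ≤ s → evenFactor s ≈[ suc K ] 1ₛ
  factor s K<s with s % 2
  ... | zero  = 1-q^-≈[]-1ₛ s K<s
  ... | suc _ = ≈[]-refl

ψ-*-oddPoch≈[]evenPoch : ∀ K → ψ *ₛ oddPoch K ≈[ suc K ] evenPoch K
ψ-*-oddPoch≈[]evenPoch K =
  ≈[]-trans (*ₛ-cong[] {ψ} ≈[]-refl (≈[]-sym (oddPoch-stable K (K + K) (m≤m+n K K))))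
  (≈[]-trans (*ₛ-cong[] (ψ≈[]qPoch⁺²*qPoch (suc K) (suc K) ≤-refl) ≈[]-refl)
  (≈[]-trans (*ₛ-cong[] {(P (suc K) *ₛ P (suc K)) *ₛ qPoch (suc K)} {(P K *ₛ P K) *ₛ qPoch K} {oddPoch (K + K)}
                        (*ₛ-cong[] (*ₛ-cong[] P-stable P-stable) (qPoch-stable (suc K) (suc K) K (n≤1+n _) ≤-refl)) ≈[]-refl)
  (≈[]-trans (≈⇒≈[] (solve 3 (λ p q o → ((p :* p) :* q) :* o := (p :* q) :* (p :* o)) ≈-refl (P K) (qPoch K) (oddPoch (K + K))))
  (≈[]-trans (*ₛ-cong[] (≈⇒≈[] (≈-sym (evenPoch-double K))) (euler K))
  (≈[]-trans (≈⇒≈[] (*ₛ-identityʳ _)) (evenPoch-stable K (K + K) (m≤m+n K K)))))))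
  where
  P : ℕ → Series
  P = qPoch⁺
  P-stable : P (suc K) ≈[ suc K ] P K
  P-stable = qPoch⁺-stable (suc K) (suc K) K (n≤1+n _) ≤-refl

-- The generating function of pod₃
fromℕ : ℕ → 𝔽₃
fromℕ zero    = 0₃
fromℕ (suc n) = 1₃ ⊕ fromℕ n

fromℕ-+ : ∀ a b → fromℕ (a + b) ≡ fromℕ a ⊕ fromℕ b
fromℕ-+ zero    b = refl
fromℕ-+ (suc a) b = trans (cong (1₃ ⊕_) (fromℕ-+ a b)) (sym (⊕-assoc 1₃ (fromℕ a) (fromℕ b)))

sign : ℕ → 𝔽₃
sign zero    = 1₃
sign (suc n) = 2₃ ⊗ sign n

sign-+ : ∀ a b → sign (a + b) ≡ sign a ⊗ sign b
sign-+ zero    b = refl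
sign-+ (suc a) b = trans (cong (2₃ ⊗_) (sign-+ a b)) (sym (⊗-assoc 2₃ (sign a) (sign b)))

sign-*2 : ∀ q → sign (q * 2) ≡ 1₃
sign-*2 zero    = refl
sign-*2 (suc q) = cong (λ x → 2₃ ⊗ (2₃ ⊗ x)) (sign-*2 q)

sign≡sign-%2 : ∀ s → sign s ≡ sign (s % 2)
sign≡sign-%2 s = begin
  sign s                                ≡⟨ cong sign (m≡m%n+[m/n]*n s 2) ⟩
  sign (s % 2 + (s / 2) * 2)            ≡⟨ sign-+ (s % 2) ((s / 2) * 2) ⟩
  sign (s % 2) ⊗ sign ((s / 2) * 2)     ≡⟨ cong (sign (s % 2) ⊗_) (sign-*2 (s / 2)) ⟩
  sign (s % 2) ⊗ 1₃                     ≡⟨ ⊗-identityʳ (sign (s % 2)) ⟩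
  sign (s % 2)                          ∎
  where open ≡-Reasoning

sign-odd : ∀ s {j} → s % 2 ≡ suc j → sign s ≡ 2₃
sign-odd s {zero}  s%2≡1 = trans (sign≡sign-%2 s) (cong sign s%2≡1)
sign-odd s {suc j} s%2≡2+j = ⊥-elim (<⇒≱ (subst (_< 2) s%2≡2+j (m%n<n s 2)) (s≤s (s≤s z≤n)))

sign-even : ∀ s → s % 2 ≡ 0 → sign s ≡ 1₃
sign-even s s%2≡0 = trans (sign≡sign-%2 s) (cong sign s%2≡0)

signedSeries : (ℕ → ℕ) → Series
signedSeries a n = sign n ⊗ fromℕ (a n)

-- Substituting q ↦ -q turns every factor of the product formula for pod₃ into one of the form 1 - qˢ.
podSeries : ℕ → Series
podSeries M = signedSeries λ n → pod₃-bounded n M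

if-≤?-> : ∀ s n (x : ℕ) → n < s → (if ⌊ s ≤? n ⌋ then x else 0) ≡ 0
if-≤?-> s n x n<s with s ≤? n
... | yes s≤n = ⊥-elim (<⇒≱ n<s s≤n)
... | no  _   = refl

+-if-≤?-> : ∀ s n a x → n < s → a + (if ⌊ s ≤? n ⌋ then x else 0) ≡ a
+-if-≤?-> s n a x n<s = trans (cong (a +_) (if-≤?-> s n x n<s)) (+-identityʳ a)

signedSeries-step : ∀ s (a b c : ℕ → ℕ) → (∀ n → a n ≡ b n + (if ⌊ s ≤? n ⌋ then c (n ∸ s) else 0)) →
                    signedSeries a ≈ signedSeries b +ₛ sign s ·ₛ shift s (signedSeries c)
signedSeries-step s a b c a≡ n = begin
  sign n ⊗ fromℕ (a n)                                  ≡⟨ cong (λ x → sign n ⊗ fromℕ x) (a≡ n) ⟩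
  sign n ⊗ fromℕ (b n + extra)                          ≡⟨ cong (sign n ⊗_) (fromℕ-+ (b n) extra) ⟩
  sign n ⊗ (fromℕ (b n) ⊕ fromℕ extra)                  ≡⟨ ⊗-distribˡ-⊕ (sign n) (fromℕ (b n)) (fromℕ extra) ⟩
  signedSeries b n ⊕ sign n ⊗ fromℕ extra               ≡⟨ cong (signedSeries b n ⊕_) shifted ⟩
  signedSeries b n ⊕ sign s ⊗ shift s (signedSeries c) n ∎
  where
  open ≡-Reasoning
  extra : ℕ
  extra = if ⌊ s ≤? n ⌋ then c (n ∸ s) else 0
  shifted : sign n ⊗ fromℕ extra ≡ sign s ⊗ shift s (signedSeries c) n
  shifted with s ≤? n
  ... | no s≰n = trans (⊗-zeroʳ (sign n)) (sym (trans (cong (sign s ⊗_) (shift-below s _ n (≰⇒> s≰n))) (⊗-zeroʳ (sign s))))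
  ... | yes s≤n with m≤n⇒∃[o]m+o≡n s≤n
  ... | d , refl = begin
    sign (s + d) ⊗ fromℕ (c (s + d ∸ s))        ≡⟨ cong (λ x → sign (s + d) ⊗ fromℕ (c x)) (m+n∸m≡n s d) ⟩
    sign (s + d) ⊗ fromℕ (c d)                  ≡⟨ cong (_⊗ fromℕ (c d)) (sign-+ s d) ⟩
    (sign s ⊗ sign d) ⊗ fromℕ (c d)             ≡⟨ ⊗-assoc (sign s) (sign d) (fromℕ (c d)) ⟩
    sign s ⊗ signedSeries c d                   ≡⟨ cong (sign s ⊗_) (shift-above s (signedSeries c) d) ⟨
    sign s ⊗ shift s (signedSeries c) (s + d)   ∎

pod₃-bounded-suc : ∀ n M → pod₃-bounded n (suc M) ≡ withPart (suc M) n M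
pod₃-bounded-suc zero    M = refl
pod₃-bounded-suc (suc n) M = refl

withPart-3∣ : ∀ s n m → s % 3 ≡ 0 → withPart s n m ≡ pod₃-bounded n m
withPart-3∣ s n m eq with s % 3
withPart-3∣ s n m refl | .zero = refl

withPart-even : ∀ s n m {k} → s % 3 ≡ suc k → s % 2 ≡ 0 → withPart s n m ≡ evenMult n n s m
withPart-even s n m e₃ e₂ with s % 3
withPart-even s n m refl e₂ | ._ with s % 2
withPart-even s n m refl refl | ._ | .zero = refl

withPart-odd : ∀ s n m {k j} → s % 3 ≡ suc k → s % 2 ≡ suc j →
               withPart s n m ≡ pod₃-bounded n m + (if ⌊ s ≤? n ⌋ then pod₃-bounded (n ∸ s) m else 0)
withPart-odd s n m e₃ e₂ with s % 3
withPart-odd s n m refl e₂ | ._ with s % 2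
withPart-odd s n m refl refl | ._ | ._ = refl

evenMult-fuel : ∀ s M f g x → 1 ≤ s → x ≤ f → x ≤ g → evenMult f x s M ≡ evenMult g x s M
evenMult-fuel s M zero    zero    x     _  _   _   = refl
evenMult-fuel s M zero    (suc g) .zero 1≤s z≤n _   = sym (+-if-≤?-> s 0 (pod₃-bounded 0 M) _ 1≤s)
evenMult-fuel s M (suc f) zero    .zero 1≤s _   z≤n = +-if-≤?-> s 0 (pod₃-bounded 0 M) _ 1≤s
evenMult-fuel s M (suc f) (suc g) x     1≤s x≤f x≤g with s ≤? x
... | yes _ = cong (pod₃-bounded x M +_) (evenMult-fuel s M f g (x ∸ s) 1≤s (x∸s≤ x≤f) (x∸s≤ x≤g))
  where
  x∸s≤ : ∀ {h} → x ≤ suc h → x ∸ s ≤ h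
  x∸s≤ x≤1+h = ≤-trans (∸-monoʳ-≤ x 1≤s) (∸-monoˡ-≤ 1 x≤1+h)
... | no  _ = refl

evenMult-step : ∀ s M n → 1 ≤ s →
  evenMult n n s M ≡ pod₃-bounded n M + (if ⌊ s ≤? n ⌋ then evenMult (n ∸ s) (n ∸ s) s M else 0)
evenMult-step s M zero    1≤s = sym (+-if-≤?-> s 0 (pod₃-bounded 0 M) _ 1≤s)
evenMult-step s M (suc n) 1≤s with s ≤? suc n
... | yes _ = cong (pod₃-bounded (suc n) M +_)
                   (evenMult-fuel s M n (suc n ∸ s) (suc n ∸ s) 1≤s (∸-monoʳ-≤ (suc n) 1≤s) ≤-refl)
... | no  _ = refl

podSeries-suc-3∣ : ∀ M → suc M % 3 ≡ 0 → podSeries (suc M) ≈ podSeries M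
podSeries-suc-3∣ M e₃ n = cong (λ x → sign n ⊗ fromℕ x) (trans (pod₃-bounded-suc n M) (withPart-3∣ (suc M) n M e₃))

podSeries-suc-odd : ∀ M {k j} → suc M % 3 ≡ suc k → suc M % 2 ≡ suc j → podSeries (suc M) ≈ podSeries M *ₛ 1-q^ (suc M)
podSeries-suc-odd M e₃ e₂ = begin
  podSeries (suc M)
    ≈⟨ signedSeries-step s _ _ (λ k → pod₃-bounded k M) (λ n → trans (pod₃-bounded-suc n M) (withPart-odd s n M e₃ e₂)) ⟩
  podSeries M +ₛ sign s ·ₛ shift s (podSeries M)
    ≈⟨ +ₛ-cong (≈-sym (*ₛ-identityʳ (podSeries M)))
               (≈-trans (λ n → cong (_⊗ shift s (podSeries M) n) (sign-odd s e₂)) (≈-sym (const-*ₛ 2₃ _))) ⟩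
  podSeries M *ₛ 1ₛ +ₛ -1ₛ *ₛ shift s (podSeries M)
    ≈⟨ +ₛ-cong (≈-refl {podSeries M *ₛ 1ₛ}) (*ₛ-cong (≈-refl { -1ₛ}) (≈-trans (shift≈q^-*ₛ s (podSeries M)) (*ₛ-comm (q^ s) (podSeries M)))) ⟩
  podSeries M *ₛ 1ₛ +ₛ -1ₛ *ₛ (podSeries M *ₛ q^ s)
    ≈⟨ solve 3 (λ b m q → b :* con 1 :+ m :* (b :* q) := b :* (con 1 :+ m :* q)) ≈-refl (podSeries M) -1ₛ (q^ s) ⟩
  podSeries M *ₛ 1-q^ s
    ∎
  where
  open ≈-Reasoning
  s : ℕ
  s = suc M

podSeries-suc-even : ∀ M {k} → suc M % 3 ≡ suc k → suc M % 2 ≡ 0 → podSeries (suc M) *ₛ 1-q^ (suc M) ≈ podSeries M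
podSeries-suc-even M e₃ e₂ = begin
  B *ₛ 1-q^ s
    ≈⟨ solve 3 (λ b m q → b :* (con 1 :+ m :* q) := b :+ m :* (q :* b)) ≈-refl B -1ₛ (q^ s) ⟩
  B +ₛ -1ₛ *ₛ (q^ s *ₛ B)
    ≈⟨ +ₛ-cong recurrence (*ₛ-cong (≈-refl { -1ₛ}) (≈-sym (shift≈q^-*ₛ s B))) ⟩
  (podSeries M +ₛ X) +ₛ -1ₛ *ₛ X
    ≈⟨ solve 3 (λ b x m → (b :+ x) :+ m :* x := b :+ (con 1 :+ m) :* x) ≈-refl (podSeries M) X -1ₛ ⟩
  podSeries M +ₛ (1ₛ +ₛ -1ₛ) *ₛ X
    ≈⟨ +ₛ-cong (≈-refl {podSeries M}) (≈-trans (*ₛ-cong 1ₛ+-1ₛ≈0ₛ (≈-refl {X})) (*ₛ-zeroˡ X)) ⟩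
  podSeries M +ₛ 0ₛ
    ≈⟨ +ₛ-identityʳ (podSeries M) ⟩
  podSeries M
    ∎
  where
  open ≈-Reasoning
  s : ℕ
  s = suc M
  B : Series
  B = podSeries s
  X : Series
  X = shift s B
  B≈evenMult : B ≈ signedSeries λ i → evenMult i i s M
  B≈evenMult i = cong (λ x → sign i ⊗ fromℕ x) (trans (pod₃-bounded-suc i M) (withPart-even s i M e₃ e₂))
  recurrence : B ≈ podSeries M +ₛ X
  recurrence = ≈-trans B≈evenMult (≈-trans (signedSeries-step s _ _ (λ k → evenMult k k s M) λ n → evenMult-step s M n (s≤s z≤n))
    (+ₛ-cong (≈-refl {podSeries M}) λ n → trans (cong (_⊗ shift s (signedSeries λ k → evenMult k k s M) n) (sign-even s e₂)) (sym (shift-cong s B≈evenMult n))))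

evenFactor∤3 oddFactor∤3 : ℕ → Series
evenFactor∤3 s = if-zero (s % 3) 1ₛ (evenFactor s)
oddFactor∤3  s = if-zero (s % 3) 1ₛ (oddFactor s)

evenPoch∤3 oddPoch∤3 : ℕ → Series
evenPoch∤3 = ∏ₛ λ i → evenFactor∤3 (suc i)
oddPoch∤3  = ∏ₛ λ i → oddFactor∤3 (suc i)

podSeries-suc : ∀ M → podSeries (suc M) *ₛ evenFactor∤3 (suc M) ≈ podSeries M *ₛ oddFactor∤3 (suc M)
podSeries-suc M with suc M % 3 in e₃ | suc M % 2 in e₂
... | zero  | _     = *ₛ-cong (podSeries-suc-3∣ M e₃) (≈-refl {1ₛ})
... | suc _ | zero  = ≈-trans (podSeries-suc-even M e₃ e₂) (≈-sym (*ₛ-identityʳ _))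
... | suc _ | suc _ = ≈-trans (*ₛ-identityʳ _) (podSeries-suc-odd M e₃ e₂)

podSeries-*-evenPoch∤3 : ∀ M → podSeries M *ₛ evenPoch∤3 M ≈ oddPoch∤3 M
podSeries-*-evenPoch∤3 zero    = ≈-trans (*ₛ-identityʳ (podSeries 0)) podSeries-0
  where
  podSeries-0 : podSeries 0 ≈ 1ₛ
  podSeries-0 zero    = refl
  podSeries-0 (suc n) = ⊗-zeroʳ _
podSeries-*-evenPoch∤3 (suc M) =
  ≈-trans (solve 3 (λ b e f → b :* (e :* f) := (b :* f) :* e) ≈-refl (podSeries (suc M)) (evenPoch∤3 M) (evenFactor∤3 (suc M)))
  (≈-trans (*ₛ-cong (podSeries-suc M) (≈-refl {evenPoch∤3 M}))
  (≈-trans (solve 3 (λ b f e → (b :* f) :* e := (b :* e) :* f) ≈-refl (podSeries M) (oddFactor∤3 (suc M)) (evenPoch∤3 M))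
           (*ₛ-cong (podSeries-*-evenPoch∤3 M) (≈-refl {oddFactor∤3 (suc M)}))))

-- Reduction modulo 3
cube : Series → Series
cube f = (f *ₛ f) *ₛ f

cube-cong[] : ∀ {f g K} → f ≈[ K ] g → cube f ≈[ K ] cube g
cube-cong[] f≈g = *ₛ-cong[] (*ₛ-cong[] f≈g f≈g) f≈g

cube-*ₛ : ∀ f g → cube (f *ₛ g) ≈ cube f *ₛ cube g
cube-*ₛ = solve 2 (λ a b → ((a :* b) :* (a :* b)) :* (a :* b) := ((a :* a) :* a) :* ((b :* b) :* b)) ≈-refl

1-q^-cube : ∀ s → cube (1-q^ s) ≈ 1-q^ (s * 3)
1-q^-cube s = begin
  cube (1-q^ s)
    ≈⟨ solve 2 (λ m x → ((con 1 :+ m :* x) :* (con 1 :+ m :* x)) :* (con 1 :+ m :* x)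
                      := con 1 :+ (m :* x :+ m :* x :+ m :* x) :+ (m :* m :* (x :* x) :+ m :* m :* (x :* x) :+ m :* m :* (x :* x)) :+ (m :* m) :* m :* ((x :* x) :* x))
               ≈-refl -1ₛ X ⟩
  1ₛ +ₛ (-1ₛ *ₛ X +ₛ -1ₛ *ₛ X +ₛ -1ₛ *ₛ X) +ₛ (Y +ₛ Y +ₛ Y) +ₛ (-1ₛ *ₛ -1ₛ) *ₛ -1ₛ *ₛ ((X *ₛ X) *ₛ X)
    ≈⟨ +ₛ-cong (+ₛ-cong (+ₛ-cong (≈-refl {1ₛ}) (f+f+f≈0ₛ (-1ₛ *ₛ X))) (f+f+f≈0ₛ Y))
               (*ₛ-cong (≈-trans (*ₛ-cong -1ₛ*-1ₛ≈1ₛ (≈-refl { -1ₛ})) (*ₛ-identityˡ -1ₛ)) X³) ⟩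
  1ₛ +ₛ 0ₛ +ₛ 0ₛ +ₛ -1ₛ *ₛ q^ (s * 3)
    ≈⟨ +ₛ-cong (≈-trans (+ₛ-identityʳ (1ₛ +ₛ 0ₛ)) (+ₛ-identityʳ 1ₛ)) (≈-refl { -1ₛ *ₛ q^ (s * 3)}) ⟩
  1-q^ (s * 3)
    ∎
  where
  open ≈-Reasoning
  X : Series
  X = q^ s
  Y : Series
  Y = -1ₛ *ₛ -1ₛ *ₛ (X *ₛ X)
  X³ : (X *ₛ X) *ₛ X ≈ q^ (s * 3)
  X³ = ≈-trans (*ₛ-cong (q^-+ s s) (≈-refl {X})) (≈-trans (q^-+ (s + s) s) (q^-≡ (3s≡ s)))
    where
    3s≡ : ∀ s → s + s + s ≡ s * 3
    3s≡ = solve-∀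

if-zero-cube : ∀ r {f g f′ g′} → cube f ≈ f′ → cube g ≈ g′ → cube (if-zero r f g) ≈ if-zero r f′ g′
if-zero-cube zero    f³ g³ = f³
if-zero-cube (suc r) f³ g³ = g³

if-zero-≡ : ∀ {r r′} f g → r ≡ r′ → if-zero r f g ≈ if-zero r′ f g
if-zero-≡ f g refl = ≈-refl

[s*3]%2≡s%2 : ∀ s → (s * 3) % 2 ≡ s % 2
[s*3]%2≡s%2 s = trans (cong (_% 2) (s*3≡ s)) ([m+kn]%n≡m%n s s 2)
  where
  s*3≡ : ∀ s → s * 3 ≡ s + s * 2
  s*3≡ = solve-∀

cube-1ₛ : cube 1ₛ ≈ 1ₛ
cube-1ₛ = ≈-trans (*ₛ-identityʳ _) (*ₛ-identityʳ _)

evenFactor-cube : ∀ s → cube (evenFactor s) ≈ evenFactor (s * 3)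
evenFactor-cube s = ≈-trans (if-zero-cube (s % 2) (1-q^-cube s) cube-1ₛ) (if-zero-≡ _ _ (sym ([s*3]%2≡s%2 s)))

oddFactor-cube : ∀ s → cube (oddFactor s) ≈ oddFactor (s * 3)
oddFactor-cube s = ≈-trans (if-zero-cube (s % 2) cube-1ₛ (1-q^-cube s)) (if-zero-≡ _ _ (sym ([s*3]%2≡s%2 s)))

[3N+1]%3≡1 : ∀ N → suc (N * 3) % 3 ≡ 1
[3N+1]%3≡1 N = [m+kn]%n≡m%n 1 N 3

[3N+2]%3≡2 : ∀ N → suc (suc (N * 3)) % 3 ≡ 2
[3N+2]%3≡2 N = [m+kn]%n≡m%n 2 N 3

[3N+3]%3≡0 : ∀ N → suc (suc (suc (N * 3))) % 3 ≡ 0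
[3N+3]%3≡0 N = [m+kn]%n≡m%n 0 (suc N) 3

-- Factors with 3 ∣ i are grouped into cubes, using (F s)³ = F (3 s).
∏ₛ-frobenius : (F : ℕ → Series) → (∀ s → cube (F s) ≈ F (s * 3)) → ∀ N →
  ∏ₛ (λ i → F (suc i)) (N * 3) ≈ ∏ₛ (λ i → if-zero (suc i % 3) 1ₛ (F (suc i))) (N * 3) *ₛ cube (∏ₛ (λ i → F (suc i)) N)
∏ₛ-frobenius F F³ zero    = ≈-sym (≈-trans (*ₛ-identityˡ _) cube-1ₛ)
∏ₛ-frobenius F F³ (suc N) = begin
  ((A *ₛ F a) *ₛ F b) *ₛ F c
    ≈⟨ *ₛ-cong (*ₛ-cong (*ₛ-cong (∏ₛ-frobenius F F³ N) (≈-refl {F a})) (≈-refl {F b})) (≈-refl {F c}) ⟩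
  ((A′ *ₛ cube B *ₛ F a) *ₛ F b) *ₛ F c
    ≈⟨ solve 5 (λ a′ cb fa fb fc → ((a′ :* cb :* fa) :* fb) :* fc := (((a′ :* fa) :* fb) :* con 1) :* (cb :* fc))
               ≈-refl A′ (cube B) (F a) (F b) (F c) ⟩
  (((A′ *ₛ F a) *ₛ F b) *ₛ 1ₛ) *ₛ (cube B *ₛ F c)
    ≈⟨ *ₛ-cong (*ₛ-cong (*ₛ-cong (*ₛ-cong (≈-refl {A′}) (≈-sym (if-zero-≡suc 1ₛ (F a) ([3N+1]%3≡1 N))))
                                 (≈-sym (if-zero-≡suc 1ₛ (F b) ([3N+2]%3≡2 N))))
                        (≈-sym (if-zero-≡0 1ₛ (F c) ([3N+3]%3≡0 N))))
               (≈-sym (≈-trans (cube-*ₛ B (F (suc N))) (*ₛ-cong (≈-refl {cube B}) (F³ (suc N))))) ⟩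
  ∏ₛ (λ i → if-zero (suc i % 3) 1ₛ (F (suc i))) (suc N * 3) *ₛ cube (∏ₛ (λ i → F (suc i)) (suc N))
    ∎
  where
  open ≈-Reasoning
  A  = ∏ₛ (λ i → F (suc i)) (N * 3)
  A′ : Series
  A′ = ∏ₛ (λ i → if-zero (suc i % 3) 1ₛ (F (suc i))) (N * 3)
  B  = ∏ₛ (λ i → F (suc i)) N
  a  = suc (N * 3)
  b  = suc a
  c  = suc b

evenPoch-constant-term : ∀ x → evenPoch x 0 ≡ 1₃
evenPoch-constant-term x = ∏ₛ-constant-term _ x λ i → factor (suc i % 2)
  where
  factor : ∀ r {s} → if-zero r (1-q^ (suc s)) 1ₛ 0 ≡ 1₃
  factor zero    = refl
  factor (suc r) = refl

podSeries≈[]ψ² : ∀ N → podSeries (N * 3) ≈[ suc N ] ψ *ₛ ψ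
podSeries≈[]ψ² N = *ₛ-cancelˡ (evenPoch L) P (ψ *ₛ ψ) (suc N) (evenPoch-constant-term L) (≈[]-trans (≈⇒≈[] lhs) (≈[]-sym rhs))
  where
  L : ℕ
  L = N * 3
  P : Series
  P = podSeries L
  lhs : evenPoch L *ₛ P ≈ oddPoch∤3 L *ₛ cube (evenPoch N)
  lhs = ≈-trans (*ₛ-comm (evenPoch L) P)
        (≈-trans (*ₛ-cong (≈-refl {P}) (∏ₛ-frobenius evenFactor evenFactor-cube N))
        (≈-trans (≈-sym (*ₛ-assoc P (evenPoch∤3 L) (cube (evenPoch N))))
                 (*ₛ-cong (podSeries-*-evenPoch∤3 L) (≈-refl {cube (evenPoch N)}))))
  rhs : evenPoch L *ₛ (ψ *ₛ ψ) ≈[ suc N ] oddPoch∤3 L *ₛ cube (evenPoch N)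
  rhs = ≈[]-trans (*ₛ-cong[] (≈[]-sym (≈[]-weaken (s≤s (m≤m*n N 3)) (ψ-*-oddPoch≈[]evenPoch L))) (≈[]-refl {ψ *ₛ ψ}))
        (≈[]-trans (≈⇒≈[] (*ₛ-cong (*ₛ-cong (≈-refl {ψ}) (∏ₛ-frobenius oddFactor oddFactor-cube N)) (≈-refl {ψ *ₛ ψ})))
        (≈[]-trans (≈⇒≈[] (solve 3 (λ p o c → (p :* (o :* ((c :* c) :* c))) :* (p :* p) := o :* (((p :* c) :* (p :* c)) :* (p :* c)))
                                   ≈-refl ψ (oddPoch∤3 L) (oddPoch N)))
                   (*ₛ-cong[] {oddPoch∤3 L} ≈[]-refl (cube-cong[] (ψ-*-oddPoch≈[]evenPoch N)))))

-- pod₃ modulo 3 counts representations by two triangular numbers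
pod₃-bounded-suc-≥ : ∀ n M → n ≤ M → pod₃-bounded n (suc M) ≡ pod₃-bounded n M
pod₃-bounded-suc-≥ n M n≤M with suc M % 3 in e₃ | suc M % 2 in e₂
... | zero  | _     = trans (pod₃-bounded-suc n M) (withPart-3∣ (suc M) n M e₃)
... | suc _ | zero  = trans (pod₃-bounded-suc n M) (trans (withPart-even (suc M) n M e₃ e₂)
                        (trans (evenMult-step (suc M) M n (s≤s z≤n)) (+-if-≤?-> (suc M) n _ _ (s≤s n≤M))))
... | suc _ | suc _ = trans (pod₃-bounded-suc n M) (trans (withPart-odd (suc M) n M e₃ e₂) (+-if-≤?-> (suc M) n _ _ (s≤s n≤M)))

pod₃-bounded-stable : ∀ n {M} → n ≤ M → pod₃-bounded n M ≡ pod₃ n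
pod₃-bounded-stable n n≤M with m≤n⇒∃[o]m+o≡n n≤M
... | d , refl = go d
  where
  go : ∀ d → pod₃-bounded n (n + d) ≡ pod₃-bounded n n
  go zero    = cong (pod₃-bounded n) (+-identityʳ n)
  go (suc d) = trans (cong (pod₃-bounded n) (+-suc n d)) (trans (pod₃-bounded-suc-≥ n (n + d) (m≤m+n n d)) (go d))

∑ℕ : (ℕ → ℕ) → ℕ → ℕ
∑ℕ f zero    = 0
∑ℕ f (suc m) = ∑ℕ f m + f m

δ : ℕ → ℕ → ℕ
δ zero    zero    = 1
δ zero    (suc _) = 0
δ (suc _) zero    = 0
δ (suc a) (suc b) = δ a b

shiftℕ : ℕ → (ℕ → ℕ) → ℕ → ℕ
shiftℕ zero    f n       = f n
shiftℕ (suc k) f zero    = 0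
shiftℕ (suc k) f (suc n) = shiftℕ k f n

-- The ranges of summation suffice because k ≤ tri k.
triReps₁ : ℕ → ℕ
triReps₁ m = ∑ℕ (λ k → δ (tri k) m) (suc m)

triReps₂ : ℕ → ℕ
triReps₂ n = ∑ℕ (λ a → shiftℕ (tri a) triReps₁ n) (suc n)

q^-coefficient : ∀ j m → (q^ j) m ≡ fromℕ (δ j m)
q^-coefficient zero    zero    = refl
q^-coefficient zero    (suc m) = refl
q^-coefficient (suc j) zero    = refl
q^-coefficient (suc j) (suc m) = q^-coefficient j m

∑ₛ-coefficient : ∀ (F : ℕ → Series) f n m → (∀ k → F k n ≡ fromℕ (f k)) → ∑ₛ F m n ≡ fromℕ (∑ℕ f m)
∑ₛ-coefficient F f n zero    F≡f = refl
∑ₛ-coefficient F f n (suc m) F≡f = trans (cong₂ _⊕_ (∑ₛ-coefficient F f n m F≡f) (F≡f m)) (sym (fromℕ-+ (∑ℕ f m) (f m)))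

ψ-coefficient : ∀ m → ψ m ≡ fromℕ (triReps₁ m)
ψ-coefficient m = ∑ₛ-coefficient (λ k → q^ (tri k)) (λ k → δ (tri k) m) m (suc m) λ k → q^-coefficient (tri k) m

shift-coefficient : ∀ k (f : ℕ → ℕ) (g : Series) → (∀ i → g i ≡ fromℕ (f i)) → ∀ n → shift k g n ≡ fromℕ (shiftℕ k f n)
shift-coefficient zero    f g g≡f n       = g≡f n
shift-coefficient (suc k) f g g≡f zero    = refl
shift-coefficient (suc k) f g g≡f (suc n) = shift-coefficient k f g g≡f n

ψ²-coefficient : ∀ n → (ψ *ₛ ψ) n ≡ fromℕ (triReps₂ n)
ψ²-coefficient n =
  trans (*ₛ-cong[] {ψ} {ψ-partial (suc n)} {ψ} {ψ} (ψ≈[]ψ-partial (suc n)) ≈[]-refl n ≤-refl)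
  (trans (*ₛ-comm (ψ-partial (suc n)) ψ n)
  (trans (*ₛ-∑ₛ ψ (λ k → q^ (tri k)) (suc n) n)
  (trans (∑ₛ-cong (suc n) (λ k _ → ≈-trans (*ₛ-comm ψ (q^ (tri k))) (≈-sym (shift≈q^-*ₛ (tri k) ψ))) n)
         (∑ₛ-coefficient (λ k → shift (tri k) ψ) (λ k → shiftℕ (tri k) triReps₁ n) n (suc n)
                         λ k → shift-coefficient (tri k) triReps₁ ψ ψ-coefficient n))))

sign*pod₃≡triReps₂ : ∀ n → sign n ⊗ fromℕ (pod₃ n) ≡ fromℕ (triReps₂ n)
sign*pod₃≡triReps₂ n =
  trans (cong (λ x → sign n ⊗ fromℕ x) (sym (pod₃-bounded-stable n (m≤m*n n 3))))
        (trans (podSeries≈[]ψ² n n ≤-refl) (ψ²-coefficient n))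

-- Binomial coefficients and Fermat's little theorem
∑ℕ-cong : ∀ {f g} n → (∀ k → k < n → f k ≡ g k) → ∑ℕ f n ≡ ∑ℕ g n
∑ℕ-cong zero    f≡g = refl
∑ℕ-cong (suc n) f≡g = cong₂ _+_ (∑ℕ-cong n λ k l → f≡g k (m≤n⇒m≤1+n l)) (f≡g n ≤-refl)

∑ℕ-first : ∀ f n → ∑ℕ f (suc n) ≡ f 0 + ∑ℕ (λ k → f (suc k)) n
∑ℕ-first f zero    = +-comm 0 (f 0)
∑ℕ-first f (suc n) = trans (cong (_+ f (suc n)) (∑ℕ-first f n)) (+-assoc (f 0) _ _)

∑ℕ-+ : ∀ f g n → ∑ℕ (λ k → f k + g k) n ≡ ∑ℕ f n + ∑ℕ g n
∑ℕ-+ f g zero    = refl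
∑ℕ-+ f g (suc n) = trans (cong (_+ (f n + g n)) (∑ℕ-+ f g n)) (+-interchange (∑ℕ f n) (∑ℕ g n) (f n) (g n))
  where
  +-interchange : ∀ a b c d → a + b + (c + d) ≡ a + c + (b + d)
  +-interchange = solve-∀

*-∑ℕ : ∀ c f n → c * ∑ℕ f n ≡ ∑ℕ (λ k → c * f k) n
*-∑ℕ c f zero    = *-zeroʳ c
*-∑ℕ c f (suc n) = trans (*-distribˡ-+ c (∑ℕ f n) (f n)) (cong (_+ c * f n) (*-∑ℕ c f n))

∣-∑ℕ : ∀ d f n → (∀ k → k < n → d ∣ f k) → d ∣ ∑ℕ f n
∣-∑ℕ d f zero    d∣f = divides 0 refl
∣-∑ℕ d f (suc n) d∣f = ∣m∣n⇒∣m+n (∣-∑ℕ d f n λ k l → d∣f k (m≤n⇒m≤1+n l)) (d∣f n ≤-refl)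

binomial : ℕ → ℕ → ℕ
binomial n       zero    = 1
binomial zero    (suc k) = 0
binomial (suc n) (suc k) = binomial n k + binomial n (suc k)

binomial-> : ∀ n k → n < k → binomial n k ≡ 0
binomial-> zero    (suc k) _       = refl
binomial-> (suc n) (suc k) (s≤s l) = cong₂ _+_ (binomial-> n k l) (binomial-> n (suc k) (m≤n⇒m≤1+n l))

binomial-diagonal : ∀ n → binomial n n ≡ 1
binomial-diagonal zero    = refl
binomial-diagonal (suc n) = cong₂ _+_ (binomial-diagonal n) (binomial-> n (suc n) ≤-refl)

binomial-1 : ∀ n → binomial n 1 ≡ n
binomial-1 zero    = refl
binomial-1 (suc n) = cong suc (binomial-1 n)

binomial-absorption : ∀ n k → suc k * binomial (suc n) (suc k) ≡ suc n * binomial n k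
binomial-absorption zero    zero    = refl
binomial-absorption zero    (suc k) = *-zeroʳ (suc (suc k))
binomial-absorption (suc n) zero    = trans (*-identityˡ _) (trans (binomial-1 (suc (suc n))) (sym (*-identityʳ _)))
binomial-absorption (suc n) (suc k) = begin
  suc (suc k) * (X + Y)                              ≡⟨ *-distribˡ-+ (suc (suc k)) X Y ⟩
  (X + suc k * X) + suc (suc k) * Y                  ≡⟨ cong₂ (λ a b → (X + a) + b) (binomial-absorption n k) (binomial-absorption n (suc k)) ⟩
  (X + suc n * binomial n k) + suc n * binomial n (suc k) ≡⟨ +-assoc X _ _ ⟩
  X + (suc n * binomial n k + suc n * binomial n (suc k)) ≡⟨ cong (X +_) (*-distribˡ-+ (suc n) (binomial n k) (binomial n (suc k))) ⟨
  X + suc n * X                                      ∎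
  where
  open ≡-Reasoning
  X : ℕ
  X = binomial (suc n) (suc k)
  Y : ℕ
  Y = binomial (suc n) (suc (suc k))

binomial-theorem : ∀ z n → (z + 1) ^ n ≡ ∑ℕ (λ k → binomial n k * z ^ k) (suc n)
binomial-theorem z zero    = refl
binomial-theorem z (suc n) = sym (begin
  ∑ℕ (λ k → binomial (suc n) k * z ^ k) (suc (suc n))
    ≡⟨ ∑ℕ-first _ (suc n) ⟩
  1 * 1 + ∑ℕ (λ k → (binomial n k + binomial n (suc k)) * z ^ suc k) (suc n)
    ≡⟨ cong (1 * 1 +_) (trans (∑ℕ-cong (suc n) λ k _ → *-distribʳ-+ (z ^ suc k) (binomial n k) (binomial n (suc k)))
                              (∑ℕ-+ _ _ (suc n))) ⟩
  1 * 1 + (∑ℕ (λ k → binomial n k * z ^ suc k) (suc n) + ∑ℕ (λ k → binomial n (suc k) * z ^ suc k) (suc n))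
    ≡⟨ rearrange (∑ℕ (λ k → binomial n k * z ^ suc k) (suc n)) (∑ℕ (λ k → binomial n (suc k) * z ^ suc k) n)
                 (binomial n (suc n) * z ^ suc n) ⟩
  ∑ℕ (λ k → binomial n k * z ^ suc k) (suc n) + (1 + ∑ℕ (λ k → binomial n (suc k) * z ^ suc k) n + binomial n (suc n) * z ^ suc n)
    ≡⟨ cong₂ _+_ (trans (∑ℕ-cong (suc n) λ k _ → swap z (binomial n k) (z ^ k)) (sym (*-∑ℕ z _ (suc n))))
                 (trans (cong₂ _+_ (cong (_+ ∑ℕ (λ k → binomial n (suc k) * z ^ suc k) n) (sym (*-identityʳ 1)))
                                   (cong (_* z ^ suc n) (binomial-> n (suc n) ≤-refl)))
                        (trans (+-identityʳ _) (sym (∑ℕ-first (λ k → binomial n k * z ^ k) n)))) ⟩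
  z * S + S
    ≡⟨ cong₂ _+_ (cong (z *_) (sym (binomial-theorem z n))) (sym (binomial-theorem z n)) ⟩
  z * (z + 1) ^ n + (z + 1) ^ n
    ≡⟨ factor z ((z + 1) ^ n) ⟩
  (z + 1) * (z + 1) ^ n
    ∎)
  where
  open ≡-Reasoning
  S : ℕ
  S = ∑ℕ (λ k → binomial n k * z ^ k) (suc n)
  rearrange : ∀ a b c → 1 * 1 + (a + (b + c)) ≡ a + (1 + b + c)
  rearrange = solve-∀
  swap : ∀ z b w → b * (z * w) ≡ z * (b * w)
  swap = solve-∀
  factor : ∀ z w → z * w + w ≡ (z + 1) * w
  factor = solve-∀

^-double : ∀ z m → z ^ (m + m) ≡ (z * z) ^ m
^-double z zero    = refl
^-double z (suc m) = trans (cong (λ e → z * z ^ e) (+-suc m m))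
                           (trans (sym (*-assoc z z (z ^ (m + m)))) (cong ((z * z) *_) (^-double z m)))

module Modulo (p-1 : ℕ) where

  p : ℕ
  p = suc p-1

  infix 4 _≡ₚ_
  _≡ₚ_ : ℕ → ℕ → Set
  x ≡ₚ y = x % p ≡ y % p

  ≡⇒≡ₚ : ∀ {x y} → x ≡ y → x ≡ₚ y
  ≡⇒≡ₚ = cong (_% p)

  +-congₚ : ∀ {x x′ y y′} → x ≡ₚ x′ → y ≡ₚ y′ → x + y ≡ₚ x′ + y′
  +-congₚ {x} {x′} {y} {y′} x≡x′ y≡y′ =
    trans (%-distribˡ-+ x y p) (trans (cong₂ (λ u v → (u + v) % p) x≡x′ y≡y′) (sym (%-distribˡ-+ x′ y′ p)))

  *-congₚ : ∀ {x x′ y y′} → x ≡ₚ x′ → y ≡ₚ y′ → x * y ≡ₚ x′ * y′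
  *-congₚ {x} {x′} {y} {y′} x≡x′ y≡y′ =
    trans (%-distribˡ-* x y p) (trans (cong₂ (λ u v → (u * v) % p) x≡x′ y≡y′) (sym (%-distribˡ-* x′ y′ p)))

  ℕ/p : CommutativeSemiring _ _
  ℕ/p = record
    { Carrier = ℕ ; _≈_ = _≡ₚ_ ; _+_ = _+_ ; _*_ = _*_ ; 0# = 0 ; 1# = 1
    ; isCommutativeSemiring = record
      { isSemiring = record
        { isSemiringWithoutAnnihilatingZero = record
          { +-isCommutativeMonoid = record
            { isMonoid = record
              { isSemigroup = record
                { isMagma = record { isEquivalence = record { refl = refl ; sym = sym ; trans = trans }
                                   ; ∙-cong = λ {x} {y} {u} {v} → +-congₚ {x} {y} {u} {v} }
                ; assoc = λ x y z → ≡⇒≡ₚ (+-assoc x y z) }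
              ; identity = (λ x → refl) , (λ x → ≡⇒≡ₚ (+-identityʳ x)) }
            ; comm = λ x y → ≡⇒≡ₚ (+-comm x y) }
          ; *-cong = λ {x} {y} {u} {v} → *-congₚ {x} {y} {u} {v}
          ; *-assoc = λ x y z → ≡⇒≡ₚ (*-assoc x y z)
          ; *-identity = (λ x → ≡⇒≡ₚ (*-identityˡ x)) , (λ x → ≡⇒≡ₚ (*-identityʳ x))
          ; distrib = (λ x y z → ≡⇒≡ₚ (*-distribˡ-+ x y z)) , (λ x y z → ≡⇒≡ₚ (*-distribʳ-+ x y z)) }
        ; zero = (λ x → refl) , (λ x → ≡⇒≡ₚ (*-zeroʳ x)) }
      ; *-comm = λ x y → ≡⇒≡ₚ (*-comm x y) } }

  open import Algebra.Solver.Ring.NaturalCoefficients.Default ℕ/p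
    renaming (solve to solveₚ; _:+_ to _:+ₚ_; _:*_ to _:*ₚ_; _:=_ to _:=ₚ_; con to conₚ)
  open import Relation.Binary.Reasoning.Setoid (CommutativeSemiring.setoid ℕ/p)

  ∣⇒≡ₚ0 : ∀ {x} → p ∣ x → x ≡ₚ 0
  ∣⇒≡ₚ0 {x} = n∣m⇒m%n≡0 x p

  x+1≡ₚ0⇒x²≡ₚ1 : ∀ x → x + 1 ≡ₚ 0 → x * x ≡ₚ 1
  x+1≡ₚ0⇒x²≡ₚ1 x x+1≡0 = begin
    x * x             ≈⟨ solveₚ 1 (λ x → x :*ₚ x :=ₚ x :*ₚ x :+ₚ conₚ 0) refl x ⟩
    x * x + 0         ≈⟨ +-congₚ {x * x} {x * x} {0} {x + 1} refl (sym x+1≡0) ⟩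
    x * x + (x + 1)   ≈⟨ solveₚ 1 (λ x → x :*ₚ x :+ₚ (x :+ₚ conₚ 1) :=ₚ x :*ₚ (x :+ₚ conₚ 1) :+ₚ conₚ 1) refl x ⟩
    x * (x + 1) + 1   ≈⟨ +-congₚ {x * (x + 1)} {x * 0} {1} {1} (*-congₚ {x} {x} {x + 1} {0} refl x+1≡0) refl ⟩
    x * 0 + 1         ≈⟨ ≡⇒≡ₚ (cong (_+ 1) (*-zeroʳ x)) ⟩
    1                 ∎

  residue≢0 : ∀ m → 0 < m → m < p → ¬ (m ≡ₚ 0)
  residue≢0 (suc m) _ m<p m≡0 with trans (sym (m<n⇒m%n≡m m<p)) m≡0
  ... | ()

  square-of-quotient : ∀ x y u → u * x ≡ₚ 1 → x * x + y * y ≡ₚ 0 → (u * y) * (u * y) + 1 ≡ₚ 0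
  square-of-quotient x y u u*x≡1 x²+y²≡0 = begin
    (u * y) * (u * y) + 1                   ≈⟨ +-congₚ {(u * y) * (u * y)} {(u * y) * (u * y)} {1} {(u * x) * (u * x)} refl
                                                       (sym (*-congₚ {u * x} {1} {u * x} {1} u*x≡1 u*x≡1)) ⟩
    (u * y) * (u * y) + (u * x) * (u * x)   ≈⟨ solveₚ 3 (λ u x y → (u :*ₚ y) :*ₚ (u :*ₚ y) :+ₚ (u :*ₚ x) :*ₚ (u :*ₚ x) :=ₚ (u :*ₚ u) :*ₚ (x :*ₚ x :+ₚ y :*ₚ y)) refl u x y ⟩
    (u * u) * (x * x + y * y)               ≈⟨ *-congₚ {u * u} {u * u} {x * x + y * y} {0} refl x²+y²≡0 ⟩
    (u * u) * 0                             ≈⟨ ≡⇒≡ₚ (*-zeroʳ (u * u)) ⟩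
    0                                       ∎

  module _ (p-prime : Prime p) where

    inverse : ∀ x → ¬ p ∣ x → Σ ℕ λ u → u * x ≡ₚ 1
    inverse x p∤x with coprime-Bézout x⊥p
      where
      x⊥p : Coprime x p
      x⊥p {d} (d∣x , d∣p) with prime⇒irreducible p-prime d∣p
      ... | inj₁ d≡1 = d≡1
      ... | inj₂ refl = ⊥-elim (p∤x d∣x)
    ... | GCD.Bézout.+- a b eq = a , sym (trans (sym ([m+kn]%n≡m%n 1 b p)) (cong (_% p) eq))
    -- Here a x + 1 = b p, so a x ≡ -1 and x has inverse a (a x).
    ... | GCD.Bézout.-+ a b eq = a * (a * x) , trans (≡⇒≡ₚ (rearrange a x))
                                    (x+1≡ₚ0⇒x²≡ₚ1 (a * x) (trans (cong (_% p) (trans (+-comm (a * x) 1) eq)) (m*n%n≡0 b p)))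
      where
      rearrange : ∀ a x → a * (a * x) * x ≡ a * x * (a * x)
      rearrange = solve-∀

    p∣binomial : ∀ k → suc k < p → p ∣ binomial p (suc k)
    p∣binomial k k<p with euclidsLemma (suc k) (binomial p (suc k)) p-prime
                           (divides (binomial p-1 k) (trans (binomial-absorption p-1 k) (*-comm p (binomial p-1 k))))
    ... | inj₁ p∣1+k = ⊥-elim (<⇒≱ k<p (∣⇒≤ p∣1+k))
    ... | inj₂ p∣C   = p∣C

    freshman's-dream : ∀ z → (z + 1) ^ p ≡ₚ z ^ p + 1
    freshman's-dream z = begin
      (z + 1) ^ p                                 ≈⟨ ≡⇒≡ₚ (binomial-theorem z p) ⟩
      ∑ℕ f (suc p)                                ≈⟨ ≡⇒≡ₚ (cong (_+ f p) (∑ℕ-first f p-1)) ⟩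
      (f 0 + ∑ℕ (λ k → f (suc k)) p-1) + f p      ≈⟨ +-congₚ {f 0 + ∑ℕ (λ k → f (suc k)) p-1} {1 + 0} {f p} {z ^ p} (+-congₚ {f 0} {1} {∑ℕ (λ k → f (suc k)) p-1} {0} refl middle)
                                                              (≡⇒≡ₚ (trans (cong (_* z ^ p) (binomial-diagonal p)) (*-identityˡ _))) ⟩
      (1 + 0) + z ^ p                             ≈⟨ ≡⇒≡ₚ (+-comm 1 (z ^ p)) ⟩
      z ^ p + 1                                   ∎
      where
      f : ℕ → ℕ
      f k = binomial p k * z ^ k
      middle : ∑ℕ (λ k → f (suc k)) p-1 ≡ₚ 0
      middle = ∣⇒≡ₚ0 (∣-∑ℕ p _ p-1 λ k k<p-1 → ∣-trans (p∣binomial k (s≤s k<p-1)) (m∣m*n (z ^ suc k)))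

    fermat : ∀ z → z ^ p ≡ₚ z
    fermat zero    = refl
    fermat (suc z) = trans (≡⇒≡ₚ (cong (_^ p) (+-comm 1 z)))
                     (trans (freshman's-dream z) (trans (+-congₚ {z ^ p} {z} {1} {1} (fermat z) refl) (≡⇒≡ₚ (+-comm z 1))))

    fermat-unit : ∀ z → ¬ p ∣ z → z ^ p-1 ≡ₚ 1
    fermat-unit z p∤z = begin
      z ^ p-1             ≈⟨ ≡⇒≡ₚ (sym (*-identityˡ (z ^ p-1))) ⟩
      1 * z ^ p-1         ≈⟨ *-congₚ {1} {v * z} {z ^ p-1} {z ^ p-1} (sym v*z≡1) refl ⟩
      (v * z) * z ^ p-1   ≈⟨ ≡⇒≡ₚ (*-assoc v z (z ^ p-1)) ⟩
      v * z ^ p           ≈⟨ *-congₚ {v} {v} {z ^ p} {z} refl (fermat z) ⟩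
      v * z               ≈⟨ v*z≡1 ⟩
      1                   ∎
      where
      v : ℕ
      v = proj₁ (inverse z p∤z)
      v*z≡1 : v * z ≡ₚ 1
      v*z≡1 = proj₂ (inverse z p∤z)

    odd-power-of-−1 : ∀ w → w + 1 ≡ₚ 0 → ∀ j → w ^ suc (j + j) + 1 ≡ₚ 0
    odd-power-of-−1 w w+1≡0 zero    = trans (≡⇒≡ₚ (cong (_+ 1) (*-identityʳ w))) w+1≡0
    odd-power-of-−1 w w+1≡0 (suc j) = begin
      w ^ suc (suc j + suc j) + 1     ≈⟨ ≡⇒≡ₚ (cong (λ e → w ^ suc e + 1) (cong suc (+-suc j j))) ⟩
      w * (w * W) + 1                 ≈⟨ solveₚ 2 (λ w a → w :*ₚ (w :*ₚ a) :+ₚ conₚ 1 :=ₚ (w :*ₚ w) :*ₚ a :+ₚ conₚ 1) refl w W ⟩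
      (w * w) * W + 1                 ≈⟨ +-congₚ {(w * w) * W} {1 * W} {1} {1} (*-congₚ {w * w} {1} {W} {W} (x+1≡ₚ0⇒x²≡ₚ1 w w+1≡0) refl) refl ⟩
      1 * W + 1                       ≈⟨ ≡⇒≡ₚ (cong (_+ 1) (*-identityˡ W)) ⟩
      W + 1                           ≈⟨ odd-power-of-−1 w w+1≡0 j ⟩
      0                               ∎
      where
      W : ℕ
      W = w ^ suc (j + j)

    -- Otherwise z = y / x satisfies z² ≡ -1, so z ^ (p - 1) = (z²) ^ ((p - 1) / 2) ≡ -1 as (p - 1) / 2 is odd,
    -- contradicting Fermat.
    p∣x²+y²⇒p∣x : p % 4 ≡ 3 → ∀ x y → p ∣ x * x + y * y → p ∣ x
    p∣x²+y²⇒p∣x p%4≡3 x y p∣x²+y² with p ∣? x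
    ... | yes p∣x = p∣x
    ... | no  p∤x = ⊥-elim (residue≢0 2 (s≤s z≤n) 3≤p (trans (+-congₚ {1} {z ^ p-1} {1} {1} (sym (fermat-unit z p∤z)) refl) z^[p-1]+1≡0))
      where
      q : ℕ
      q = p / 4
      p≡4q+3 : p ≡ 3 + q * 4
      p≡4q+3 = trans (m≡m%n+[m/n]*n p 4) (cong (_+ q * 4) p%4≡3)
      rearrange : ∀ q → 3 + q * 4 ≡ suc (suc (q + q) + suc (q + q))
      rearrange = solve-∀
      3≤p : 3 ≤ p
      3≤p = subst (3 ≤_) (sym p≡4q+3) (m≤m+n 3 _)
      u : ℕ
      u = proj₁ (inverse x p∤x)
      z : ℕ
      z = u * y
      z²+1≡0 : z * z + 1 ≡ₚ 0
      z²+1≡0 = square-of-quotient x y u (proj₂ (inverse x p∤x)) (∣⇒≡ₚ0 p∣x²+y²)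
      p∤z : ¬ p ∣ z
      p∤z p∣z = residue≢0 1 (s≤s z≤n) (≤-trans (s≤s (s≤s z≤n)) 3≤p) (begin
        1                               ≈⟨ ≡⇒≡ₚ (cong (_+ 1) (sym (*-zeroʳ z))) ⟩
        z * 0 + 1                       ≈⟨ +-congₚ {z * 0} {z * z} {1} {1} (*-congₚ {z} {z} {0} {z} refl (sym (∣⇒≡ₚ0 p∣z))) refl ⟩
        z * z + 1                       ≈⟨ z²+1≡0 ⟩
        0                               ∎)
      z^[p-1]+1≡0 : z ^ p-1 + 1 ≡ₚ 0
      z^[p-1]+1≡0 = trans (≡⇒≡ₚ (cong (_+ 1) (trans (cong (z ^_) (suc-injective (trans p≡4q+3 (rearrange q))))
                                                   (^-double z (suc (q + q))))))
                          (odd-power-of-−1 (z * z) z²+1≡0 q)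

-- Representations by two triangular numbers under n ↦ p²n + (p² - 1)/4
tri-*2 : ∀ x → tri x * 2 ≡ x * suc x
tri-*2 zero    = refl
tri-*2 (suc x) = trans (*-distribʳ-+ 2 (suc x) (tri x)) (trans (cong (suc x * 2 +_) (tri-*2 x)) (rearrange x))
  where
  rearrange : ∀ x → suc x * 2 + x * suc x ≡ suc x * suc (suc x)
  rearrange = solve-∀

[2x+1]²≡8tri+1 : ∀ x → suc (x + x) * suc (x + x) ≡ 8 * tri x + 1
[2x+1]²≡8tri+1 x = trans (expand x) (trans (cong (λ t → 4 * t + 1) (sym (tri-*2 x))) (regroup (tri x)))
  where
  expand : ∀ x → suc (x + x) * suc (x + x) ≡ 4 * (x * suc x) + 1
  expand = solve-∀
  regroup : ∀ t → 4 * (t * 2) + 1 ≡ 8 * t + 1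
  regroup = solve-∀

δ-refl : ∀ a → δ a a ≡ 1
δ-refl zero    = refl
δ-refl (suc a) = δ-refl a

δ-≢ : ∀ a b → a ≢ b → δ a b ≡ 0
δ-≢ zero    zero    a≢b = ⊥-elim (a≢b refl)
δ-≢ zero    (suc b) a≢b = refl
δ-≢ (suc a) zero    a≢b = refl
δ-≢ (suc a) (suc b) a≢b = δ-≢ a b λ a≡b → a≢b (cong suc a≡b)

δ≢0⇒≡ : ∀ a b → δ a b ≢ 0 → a ≡ b
δ≢0⇒≡ a b δ≢0 with a ≟ b
... | yes a≡b = a≡b
... | no  a≢b = ⊥-elim (δ≢0 (δ-≢ a b a≢b))

δ-cong-⇔ : ∀ a b a′ b′ → (a ≡ b → a′ ≡ b′) → (a′ ≡ b′ → a ≡ b) → δ a b ≡ δ a′ b′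
δ-cong-⇔ a b a′ b′ to from with a ≟ b
... | yes refl = trans (δ-refl a) (sym (subst (λ x → δ a′ x ≡ 1) (to refl) (δ-refl a′)))
... | no  a≢b  = trans (δ-≢ a b a≢b) (sym (δ-≢ a′ b′ λ e → a≢b (from e)))

shiftℕ-above : ∀ k f d → shiftℕ k f (k + d) ≡ f d
shiftℕ-above zero    f d = refl
shiftℕ-above (suc k) f d = shiftℕ-above k f d

shiftℕ-below : ∀ k f n → n < k → shiftℕ k f n ≡ 0
shiftℕ-below (suc k) f zero    _       = refl
shiftℕ-below (suc k) f (suc n) (s≤s l) = shiftℕ-below k f n l

∑ℕ-zero : ∀ f n → (∀ k → k < n → f k ≡ 0) → ∑ℕ f n ≡ 0
∑ℕ-zero f zero    f≡0 = refl
∑ℕ-zero f (suc n) f≡0 = cong₂ _+_ (∑ℕ-zero f n λ k l → f≡0 k (m≤n⇒m≤1+n l)) (f≡0 n ≤-refl)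

∑ℕ-split : ∀ f a b → ∑ℕ f (a + b) ≡ ∑ℕ f a + ∑ℕ (λ i → f (a + i)) b
∑ℕ-split f a zero    = trans (cong (∑ℕ f) (+-identityʳ a)) (sym (+-identityʳ _))
∑ℕ-split f a (suc b) = trans (cong (∑ℕ f) (+-suc a b))
                      (trans (cong (_+ f (a + b)) (∑ℕ-split f a b)) (+-assoc (∑ℕ f a) (∑ℕ (λ i → f (a + i)) b) (f (a + b))))

∑ℕ-extend : ∀ f A B → A ≤ B → (∀ k → A ≤ k → f k ≡ 0) → ∑ℕ f B ≡ ∑ℕ f A
∑ℕ-extend f A B A≤B f≡0 with m≤n⇒∃[o]m+o≡n A≤B
... | d , refl = trans (∑ℕ-split f A d)
                 (trans (cong (∑ℕ f A +_) (∑ℕ-zero _ d λ i _ → f≡0 (A + i) (m≤m+n A i))) (+-identityʳ _))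

∑ℕ-blocks : ∀ p f L → ∑ℕ f (p * L) ≡ ∑ℕ (λ a → ∑ℕ (λ r → f (p * a + r)) p) L
∑ℕ-blocks p f zero    = cong (∑ℕ f) (*-zeroʳ p)
∑ℕ-blocks p f (suc L) = trans (cong (∑ℕ f) (trans (*-suc p L) (+-comm p (p * L))))
                        (trans (∑ℕ-split f (p * L) p) (cong (_+ ∑ℕ (λ r → f (p * L + r)) p) (∑ℕ-blocks p f L)))

∑ℕ-single : ∀ g p h → h < p → (∀ r → r < p → r ≢ h → g r ≡ 0) → ∑ℕ g p ≡ g h
∑ℕ-single g p h h<p g≡0 with m≤n⇒∃[o]m+o≡n h<p
... | d , refl = trans (∑ℕ-split g (suc h) d)
    (trans (cong₂ _+_ (cong (_+ g h) (∑ℕ-zero g h λ k k<h → g≡0 k (<-trans k<h (m≤m+n (suc h) d)) λ k≡h → <-irrefl k≡h k<h))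
                      (∑ℕ-zero _ d λ i i<d → g≡0 (suc h + i) (+-monoʳ-< (suc h) i<d) λ e → <-irrefl (sym e) (m≤m+n (suc h) i)))
           (+-identityʳ _))

∑ℕ-nonzero : ∀ f n → ∑ℕ f n ≢ 0 → Σ ℕ λ k → k < n × f k ≢ 0
∑ℕ-nonzero f zero    ∑≢0 = ⊥-elim (∑≢0 refl)
∑ℕ-nonzero f (suc n) ∑≢0 with f n ≟ 0
... | no  fn≢0 = n , ≤-refl , fn≢0
... | yes fn≡0 with ∑ℕ-nonzero f n (λ ∑≡0 → ∑≢0 (cong₂ _+_ ∑≡0 fn≡0))
...   | k , k<n , fk≢0 = k , m≤n⇒m≤1+n k<n , fk≢0

triReps₁≢0⇒triangular : ∀ d → triReps₁ d ≢ 0 → Σ ℕ λ b → tri b ≡ d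
triReps₁≢0⇒triangular d reps≢0 with ∑ℕ-nonzero _ (suc d) reps≢0
... | b , _ , δ≢0 = b , δ≢0⇒≡ (tri b) d δ≢0

even-or-odd : ∀ q → Σ ℕ λ m → q ≡ m + m ⊎ q ≡ suc (m + m)
even-or-odd zero    = 0 , inj₁ refl
even-or-odd (suc q) with even-or-odd q
... | m , inj₁ refl = m , inj₂ refl
... | m , inj₂ refl = suc m , inj₁ (cong suc (sym (+-suc m m)))

odd≢even : ∀ a b → suc (a + a) ≢ b + b
odd≢even a       zero    ()
odd≢even zero    (suc b) eq with trans (suc-injective eq) (+-suc b b)
... | ()
odd≢even (suc a) (suc b) eq =
  odd≢even a b (suc-injective (trans (sym (cong suc (+-suc a a))) (trans (suc-injective eq) (+-suc b b))))

x+x≡y+y⇒x≡y : ∀ {x y} → x + x ≡ y + y → x ≡ y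
x+x≡y+y⇒x≡y {x} {y} eq = *-cancelʳ-≡ x y 2 (trans (double x) (trans eq (sym (double y))))
  where
  double : ∀ x → x * 2 ≡ x + x
  double = solve-∀

module TriangularScaling (h : ℕ) (p-prime : Prime (suc (h + h))) (p%4≡3 : suc (h + h) % 4 ≡ 3) where

  p : ℕ
  p = suc (h + h)

  c : ℕ
  c = tri h

  p²≡8c+1 : p * p ≡ 8 * c + 1
  p²≡8c+1 = [2x+1]²≡8tri+1 h

  h<p : h < p
  h<p = s≤s (m≤m+n h h)

  tri-[pa+h] : ∀ a → tri (p * a + h) ≡ p * p * tri a + c
  tri-[pa+h] a = *-cancelʳ-≡ _ _ 2 (trans (tri-*2 (p * a + h)) (trans (expand h a)
                   (sym (trans (*-distribʳ-+ 2 (p * p * tri a) c)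
                               (cong₂ _+_ (trans (*-assoc (p * p) (tri a) 2) (cong (p * p *_) (tri-*2 a))) (tri-*2 h))))))
    where
    expand : ∀ h a → (suc (h + h) * a + h) * suc (suc (h + h) * a + h) ≡ suc (h + h) * suc (h + h) * (a * suc a) + h * suc h
    expand = solve-∀

  [pa+r]%p≡r%p : ∀ a r → (p * a + r) % p ≡ r % p
  [pa+r]%p≡r%p a r = trans (cong (_% p) (trans (+-comm (p * a) r) (cong (r +_) (*-comm p a)))) ([m+kn]%n≡m%n r a p)

  residue-unique : ∀ a r b s → r < p → s < p → p * a + r ≡ p * b + s → r ≡ s
  residue-unique a r b s r<p s<p eq =
    trans (sym (m<n⇒m%n≡m r<p)) (trans (sym ([pa+r]%p≡r%p a r))
          (trans (cong (_% p) eq) (trans ([pa+r]%p≡r%p b s) (m<n⇒m%n≡m s<p))))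

  p∣2x+1⇒x≡h : ∀ x → p ∣ suc (x + x) → Σ ℕ λ x′ → x ≡ p * x′ + h
  p∣2x+1⇒x≡h x (divides q 2x+1≡qp) with even-or-odd q
  ... | m , inj₁ refl = ⊥-elim (odd≢even x (p * m) (trans 2x+1≡qp (rearrange h m)))
    where
    rearrange : ∀ h m → (m + m) * suc (h + h) ≡ suc (h + h) * m + suc (h + h) * m
    rearrange = solve-∀
  ... | m , inj₂ refl = m , x+x≡y+y⇒x≡y (suc-injective (trans 2x+1≡qp (rearrange h m)))
    where
    rearrange : ∀ h m → suc (m + m) * suc (h + h) ≡ suc ((suc (h + h) * m + h) + (suc (h + h) * m + h))
    rearrange = solve-∀

  p∣a²⇒p∣a : ∀ a → p ∣ a * a → p ∣ a
  p∣a²⇒p∣a a p∣a² with euclidsLemma a a p-prime p∣a²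
  ... | inj₁ p∣a = p∣a
  ... | inj₂ p∣a = p∣a

  tri-descent : ∀ b m → tri b ≡ p * p * m + c → Σ ℕ λ b′ → tri b′ ≡ m × b ≡ p * b′ + h
  tri-descent b m tri≡ = descend (p∣2x+1⇒x≡h b (p∣a²⇒p∣a (suc (b + b)) (divides (p * (8 * m + 1)) square)))
    where
    rearrange₁ : ∀ P m c → 8 * (P * m + c) + 1 ≡ P * (8 * m) + (8 * c + 1)
    rearrange₁ = solve-∀
    rearrange₂ : ∀ p m → p * p * (8 * m) + p * p ≡ p * (8 * m + 1) * p
    rearrange₂ = solve-∀
    square : suc (b + b) * suc (b + b) ≡ p * (8 * m + 1) * p
    square = trans ([2x+1]²≡8tri+1 b) (trans (cong (λ t → 8 * t + 1) tri≡)
               (trans (rearrange₁ (p * p) m c) (trans (cong (p * p * (8 * m) +_) (sym p²≡8c+1)) (rearrange₂ p m))))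
    descend : (Σ ℕ λ b′ → b ≡ p * b′ + h) → Σ ℕ λ b′ → tri b′ ≡ m × b ≡ p * b′ + h
    descend (b′ , b≡) = b′ , *-cancelˡ-≡ (tri b′) m (p * p)
                               (+-cancelʳ-≡ c (p * p * tri b′) (p * p * m) (trans (sym (tri-[pa+h] b′)) (trans (cong tri (sym b≡)) tri≡)))
                       , b≡

  tri+tri≡p²m+2c⇒p∣2a+1 : ∀ a b m → tri a + tri b ≡ p * p * m + (c + c) → p ∣ suc (a + a)
  tri+tri≡p²m+2c⇒p∣2a+1 a b m tri+tri≡ =
    Modulo.p∣x²+y²⇒p∣x (h + h) p-prime p%4≡3 (suc (a + a)) (suc (b + b)) (divides (p * (8 * m + 2)) squares)
    where
    rearrange₁ : ∀ x y → 8 * x + 1 + (8 * y + 1) ≡ 8 * (x + y) + 2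
    rearrange₁ = solve-∀
    rearrange₂ : ∀ P m c → 8 * (P * m + (c + c)) + 2 ≡ P * (8 * m) + ((8 * c + 1) + (8 * c + 1))
    rearrange₂ = solve-∀
    rearrange₃ : ∀ p m → p * p * (8 * m) + (p * p + p * p) ≡ p * (8 * m + 2) * p
    rearrange₃ = solve-∀
    squares : suc (a + a) * suc (a + a) + suc (b + b) * suc (b + b) ≡ p * (8 * m + 2) * p
    squares = trans (cong₂ _+_ ([2x+1]²≡8tri+1 a) ([2x+1]²≡8tri+1 b))
              (trans (rearrange₁ (tri a) (tri b)) (trans (cong (λ t → 8 * t + 2) tri+tri≡)
              (trans (rearrange₂ (p * p) m c) (trans (cong (λ t → p * p * (8 * m) + (t + t)) (sym p²≡8c+1)) (rearrange₃ p m)))))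

  <tri : ∀ k n → n < k → n < tri k
  <tri k n n<k = ≤-trans n<k (n≤tri[n] k)

  triReps₁-scale : ∀ m → triReps₁ (p * p * m + c) ≡ triReps₁ m
  triReps₁-scale m = begin
    ∑ℕ F (suc N)                                     ≡⟨ ∑ℕ-extend F (suc N) (p * suc N) (m≤n*m (suc N) p)
                                                          (λ k k>N → δ-≢ (tri k) N λ e → <-irrefl (sym e) (<tri k N k>N)) ⟨
    ∑ℕ F (p * suc N)                                 ≡⟨ ∑ℕ-blocks p F (suc N) ⟩
    ∑ℕ (λ a → ∑ℕ (λ r → F (p * a + r)) p) (suc N)    ≡⟨ ∑ℕ-cong (suc N) (λ a _ → block a) ⟩
    ∑ℕ (λ a → δ (tri a) m) (suc N)                   ≡⟨ ∑ℕ-extend (λ a → δ (tri a) m) (suc m) (suc N)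
                                                          (s≤s (≤-trans (m≤n*m m (p * p)) (m≤m+n (p * p * m) c)))
                                                          (λ a a>m → δ-≢ (tri a) m λ e → <-irrefl (sym e) (<tri a m a>m)) ⟩
    ∑ℕ (λ a → δ (tri a) m) (suc m)                   ∎
    where
    open ≡-Reasoning
    N : ℕ
    N = p * p * m + c
    F : ℕ → ℕ
    F k = δ (tri k) N
    residue : ∀ a r → r < p → tri (p * a + r) ≡ N → r ≡ h
    residue a r r<p tri≡ = residue-unique a r (proj₁ (tri-descent (p * a + r) m tri≡)) h r<p h<p (proj₂ (proj₂ (tri-descent (p * a + r) m tri≡)))
    block : ∀ a → ∑ℕ (λ r → F (p * a + r)) p ≡ δ (tri a) m
    block a = trans (∑ℕ-single (λ r → F (p * a + r)) p h h<p λ r r<p r≢h → δ-≢ (tri (p * a + r)) N λ e → r≢h (residue a r r<p e))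
                    (δ-cong-⇔ (tri (p * a + h)) N (tri a) m
                       (λ e → *-cancelˡ-≡ (tri a) m (p * p) (+-cancelʳ-≡ c (p * p * tri a) (p * p * m) (trans (sym (tri-[pa+h] a)) e)))
                       (λ e → trans (tri-[pa+h] a) (cong (λ t → p * p * t + c) e)))

  module _ (m : ℕ) where

    private
      N : ℕ
      N = p * p * m + (c + c)

      g : ℕ → ℕ
      g k = shiftℕ (tri k) triReps₁ N

    -- A representation N = tri a + tri b forces a ≡ h (mod p).
    off-residue : ∀ a r → r < p → r ≢ h → ∀ d → tri (p * a + r) + d ≡ N → Dec (triReps₁ d ≡ 0) → triReps₁ d ≡ 0
    off-residue a r r<p r≢h d eq (yes reps≡0) = reps≡0
    off-residue a r r<p r≢h d eq (no reps≢0)  = ⊥-elim (r≢h (residue-unique a r (proj₁ a≡) h r<p h<p (proj₂ a≡)))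
      where
      b : Σ ℕ λ b → tri b ≡ d
      b = triReps₁≢0⇒triangular d reps≢0
      a≡ : Σ ℕ λ x′ → p * a + r ≡ p * x′ + h
      a≡ = p∣2x+1⇒x≡h (p * a + r) (tri+tri≡p²m+2c⇒p∣2a+1 (p * a + r) (proj₁ b) m (trans (cong (tri (p * a + r) +_) (proj₂ b)) eq))

    off-residue-term : ∀ a r → r < p → r ≢ h → Dec (tri (p * a + r) ≤ N) → g (p * a + r) ≡ 0
    off-residue-term a r r<p r≢h (no  tri≰N) = shiftℕ-below _ triReps₁ N (≰⇒> tri≰N)
    off-residue-term a r r<p r≢h (yes tri≤N) with m≤n⇒∃[o]m+o≡n tri≤N
    ... | d , eq = trans (cong (shiftℕ (tri (p * a + r)) triReps₁) (sym eq))
                         (trans (shiftℕ-above (tri (p * a + r)) triReps₁ d) (off-residue a r r<p r≢h d eq (triReps₁ d ≟ 0)))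

    on-residue-≤ : ∀ a → Σ ℕ (λ d → tri a + d ≡ m) → g (p * a + h) ≡ shiftℕ (tri a) triReps₁ m
    on-residue-≤ a (d , eq) = begin
      shiftℕ (tri (p * a + h)) triReps₁ N                           ≡⟨ cong (λ t → shiftℕ t triReps₁ N) (tri-[pa+h] a) ⟩
      shiftℕ (p * p * tri a + c) triReps₁ N                         ≡⟨ cong (shiftℕ (p * p * tri a + c) triReps₁)
                                                                          (trans (cong (λ t → p * p * t + (c + c)) (sym eq)) (rearrange (p * p) (tri a) d c)) ⟩
      shiftℕ (p * p * tri a + c) triReps₁ ((p * p * tri a + c) + (p * p * d + c))
                                                                    ≡⟨ shiftℕ-above (p * p * tri a + c) triReps₁ (p * p * d + c) ⟩
      triReps₁ (p * p * d + c)                                      ≡⟨ triReps₁-scale d ⟩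
      triReps₁ d                                                    ≡⟨ shiftℕ-above (tri a) triReps₁ d ⟨
      shiftℕ (tri a) triReps₁ (tri a + d)                           ≡⟨ cong (shiftℕ (tri a) triReps₁) eq ⟩
      shiftℕ (tri a) triReps₁ m                                     ∎
      where
      open ≡-Reasoning
      rearrange : ∀ P t d c → P * (t + d) + (c + c) ≡ (P * t + c) + (P * d + c)
      rearrange = solve-∀

    on-residue-> : ∀ a → m < tri a → g (p * a + h) ≡ shiftℕ (tri a) triReps₁ m
    on-residue-> a m<tri = trans (cong (λ t → shiftℕ t triReps₁ N) (tri-[pa+h] a))
                           (trans (shiftℕ-below (p * p * tri a + c) triReps₁ N N<) (sym (shiftℕ-below (tri a) triReps₁ m m<tri)))
      where
      rearrange : ∀ P m c → suc (P * m + (c + c)) + 7 * c ≡ P * m + (8 * c + 1) + c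
      rearrange = solve-∀
      N< : N < p * p * tri a + c
      N< = ≤-trans (subst (suc N ≤_) (rearrange (p * p) m c) (m≤m+n (suc N) (7 * c)))
                   (subst (λ t → t + c ≤ p * p * tri a + c) (trans (*-suc (p * p) m) (trans (+-comm (p * p) (p * p * m)) (cong (p * p * m +_) p²≡8c+1)))
                          (+-monoˡ-≤ c (*-monoʳ-≤ (p * p) m<tri)))

    on-residue : ∀ a → Dec (tri a ≤ m) → g (p * a + h) ≡ shiftℕ (tri a) triReps₁ m
    on-residue a (yes tri≤m) = on-residue-≤ a (m≤n⇒∃[o]m+o≡n tri≤m)
    on-residue a (no  tri≰m) = on-residue-> a (≰⇒> tri≰m)

    triReps₂-block : ∀ a → ∑ℕ (λ r → g (p * a + r)) p ≡ shiftℕ (tri a) triReps₁ m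
    triReps₂-block a = trans (∑ℕ-single (λ r → g (p * a + r)) p h h<p λ r r<p r≢h → off-residue-term a r r<p r≢h (tri (p * a + r) ≤? N))
                             (on-residue a (tri a ≤? m))

    triReps₂-scale : triReps₂ N ≡ triReps₂ m
    triReps₂-scale = begin
      ∑ℕ g (suc N)                                     ≡⟨ ∑ℕ-extend g (suc N) (p * suc N) (m≤n*m (suc N) p)
                                                            (λ k k>N → shiftℕ-below (tri k) triReps₁ N (<tri k N k>N)) ⟨
      ∑ℕ g (p * suc N)                                 ≡⟨ ∑ℕ-blocks p g (suc N) ⟩
      ∑ℕ (λ a → ∑ℕ (λ r → g (p * a + r)) p) (suc N)    ≡⟨ ∑ℕ-cong (suc N) (λ a _ → triReps₂-block a) ⟩
      ∑ℕ (λ a → shiftℕ (tri a) triReps₁ m) (suc N)     ≡⟨ ∑ℕ-extend (λ a → shiftℕ (tri a) triReps₁ m) (suc m) (suc N)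
                                                            (s≤s (≤-trans (m≤n*m m (p * p)) (m≤m+n (p * p * m) (c + c))))
                                                            (λ a a>m → shiftℕ-below (tri a) triReps₁ m (<tri a m a>m)) ⟩
      ∑ℕ (λ a → shiftℕ (tri a) triReps₁ m) (suc m)     ∎
      where open ≡-Reasoning

sign-square : ∀ n → sign n ⊗ sign n ≡ 1₃
sign-square n = trans (sym (sign-+ n n)) (trans (cong sign (double n)) (sign-*2 n))
  where
  double : ∀ n → n + n ≡ n * 2
  double = solve-∀

sign-cancel : ∀ n {x y} → sign n ⊗ x ≡ sign n ⊗ y → x ≡ y
sign-cancel n {x} {y} eq = begin
  x                        ≡⟨ cong (_⊗ x) (sign-square n) ⟨
  (sign n ⊗ sign n) ⊗ x    ≡⟨ ⊗-assoc (sign n) (sign n) x ⟩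
  sign n ⊗ (sign n ⊗ x)    ≡⟨ cong (sign n ⊗_) eq ⟩
  sign n ⊗ (sign n ⊗ y)    ≡⟨ ⊗-assoc (sign n) (sign n) y ⟨
  (sign n ⊗ sign n) ⊗ y    ≡⟨ cong (_⊗ y) (sign-square n) ⟩
  y                        ∎
  where open ≡-Reasoning

toℕ : 𝔽₃ → ℕ
toℕ 0₃ = 0
toℕ 1₃ = 1
toℕ 2₃ = 2

toℕ-fromℕ : ∀ a → toℕ (fromℕ a) ≡ a % 3
toℕ-fromℕ 0 = refl
toℕ-fromℕ 1 = refl
toℕ-fromℕ 2 = refl
toℕ-fromℕ (suc (suc (suc a))) =
  trans (cong toℕ (1⊕1⊕1⊕x≡x (fromℕ a))) (trans (toℕ-fromℕ a) (sym (trans (cong (_% 3) (+-comm 3 a)) ([m+n]%n≡m%n a 3))))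
  where
  1⊕1⊕1⊕x≡x : ∀ x → 1₃ ⊕ (1₃ ⊕ (1₃ ⊕ x)) ≡ x
  1⊕1⊕1⊕x≡x = by-exhaustion¹ λ x → 1₃ ⊕ (1₃ ⊕ (1₃ ⊕ x)) ≟₃ x

fromℕ-injective-mod-3 : ∀ a b → fromℕ a ≡ fromℕ b → a % 3 ≡ b % 3
fromℕ-injective-mod-3 a b eq = trans (sym (toℕ-fromℕ a)) (trans (cong toℕ eq) (toℕ-fromℕ b))

module _ (h : ℕ) (p-prime : Prime (suc (h + h))) (p%4≡3 : suc (h + h) % 4 ≡ 3) where

  open TriangularScaling h p-prime p%4≡3

  pod₃-scale : ∀ m → fromℕ (pod₃ (p * p * m + (c + c))) ≡ fromℕ (pod₃ m)
  pod₃-scale m = sign-cancel m (begin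
    sign m ⊗ fromℕ (pod₃ N)    ≡⟨ cong (_⊗ fromℕ (pod₃ N)) sign-N ⟨
    sign N ⊗ fromℕ (pod₃ N)    ≡⟨ sign*pod₃≡triReps₂ N ⟩
    fromℕ (triReps₂ N)         ≡⟨ cong fromℕ (triReps₂-scale m) ⟩
    fromℕ (triReps₂ m)         ≡⟨ sign*pod₃≡triReps₂ m ⟨
    sign m ⊗ fromℕ (pod₃ m)    ∎)
    where
    open ≡-Reasoning
    N : ℕ
    N = p * p * m + (c + c)
    rearrange : ∀ c m → (8 * c + 1) * m + (c + c) ≡ m + (4 * c * m + c) * 2
    rearrange = solve-∀
    sign-N : sign N ≡ sign m
    sign-N = trans (cong sign (trans (cong (λ t → t * m + (c + c)) p²≡8c+1) (rearrange c m)))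
             (trans (sign-+ m ((4 * c * m + c) * 2)) (trans (cong (sign m ⊗_) (sign-*2 (4 * c * m + c))) (⊗-identityʳ (sign m))))

  -- e k is chosen so that p ^ (2 k) = 8 e k + 1, i.e. (p ^ (2 k) - 1) / 4 = 2 e k.
  e : ℕ → ℕ
  e zero    = 0
  e (suc k) = p * p * e k + c

  p^[2k]≡[p²]^k : ∀ k → p ^ (2 * k) ≡ (p * p) ^ k
  p^[2k]≡[p²]^k k = trans (sym (^-*-assoc p 2 k)) (cong (λ x → (p * x) ^ k) (*-identityʳ p))

  [p²]^k≡8e+1 : ∀ k → (p * p) ^ k ≡ 8 * e k + 1
  [p²]^k≡8e+1 zero    = refl
  [p²]^k≡8e+1 (suc k) = begin
    p * p * (p * p) ^ k                    ≡⟨ cong (p * p *_) ([p²]^k≡8e+1 k) ⟩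
    p * p * (8 * e k + 1)                  ≡⟨ expand (p * p) (e k) ⟩
    8 * (p * p * e k) + p * p              ≡⟨ cong (8 * (p * p * e k) +_) p²≡8c+1 ⟩
    8 * (p * p * e k) + (8 * c + 1)        ≡⟨ regroup (p * p * e k) c ⟩
    8 * (p * p * e k + c) + 1              ∎
    where
    open ≡-Reasoning
    expand : ∀ P d → P * (8 * d + 1) ≡ 8 * (P * d) + P
    expand = solve-∀
    regroup : ∀ x c → 8 * x + (8 * c + 1) ≡ 8 * (x + c) + 1
    regroup = solve-∀

  [p^2k∸1]/4≡2e : ∀ k → (p ^ (2 * k) ∸ 1) / 4 ≡ e k + e k
  [p^2k∸1]/4≡2e k = begin
    (p ^ (2 * k) ∸ 1) / 4       ≡⟨ cong (λ x → (x ∸ 1) / 4) (trans (p^[2k]≡[p²]^k k) ([p²]^k≡8e+1 k)) ⟩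
    (8 * e k + 1 ∸ 1) / 4       ≡⟨ cong (_/ 4) (trans (m+n∸n≡m (8 * e k) 1) (8d≡ (e k))) ⟩
    (e k + e k) * 4 / 4         ≡⟨ m*n/n≡m (e k + e k) 4 ⟩
    e k + e k                   ∎
    where
    open ≡-Reasoning
    8d≡ : ∀ d → 8 * d ≡ (d + d) * 4
    8d≡ = solve-∀

  index-step : ∀ k n → (p * p) ^ suc k * n + (e (suc k) + e (suc k)) ≡ p * p * ((p * p) ^ k * n + (e k + e k)) + (c + c)
  index-step k n = rearrange (p * p) ((p * p) ^ k) n (e k) c
    where
    rearrange : ∀ P X n d c → P * X * n + ((P * d + c) + (P * d + c)) ≡ P * (X * n + (d + d)) + (c + c)
    rearrange = solve-∀

  pod₃-iterate : ∀ k n → fromℕ (pod₃ ((p * p) ^ k * n + (e k + e k))) ≡ fromℕ (pod₃ n)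
  pod₃-iterate zero    n = cong (λ x → fromℕ (pod₃ x)) (trans (+-identityʳ (1 * n)) (*-identityˡ n))
  pod₃-iterate (suc k) n = trans (cong (λ x → fromℕ (pod₃ x)) (index-step k n))
                                 (trans (pod₃-scale ((p * p) ^ k * n + (e k + e k))) (pod₃-iterate k n))

  pod₃-congruence : ∀ k n → pod₃ (p ^ (2 * k) * n + (p ^ (2 * k) ∸ 1) / 4) % 3 ≡ pod₃ n % 3
  pod₃-congruence k n = fromℕ-injective-mod-3 (pod₃ (p ^ (2 * k) * n + (p ^ (2 * k) ∸ 1) / 4)) (pod₃ n)
    (trans (cong (λ x → fromℕ (pod₃ x)) (cong₂ (λ a b → a * n + b) (p^[2k]≡[p²]^k k) ([p^2k∸1]/4≡2e k))) (pod₃-iterate k n))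

p%4≡3⇒p≡2h+1 : ∀ p → p % 4 ≡ 3 → Σ ℕ λ h → p ≡ suc (h + h)
p%4≡3⇒p≡2h+1 p p%4≡3 = suc (p / 4 + p / 4) , trans (m≡m%n+[m/n]*n p 4) (trans (cong (_+ p / 4 * 4) p%4≡3) (rearrange (p / 4)))
  where
  rearrange : ∀ q → 3 + q * 4 ≡ suc (suc (q + q) + suc (q + q))
  rearrange = solve-∀

-- The congruence also holds for k = 0.
corollary2 : (k : ℕ) → 1 ≤ k → (p : ℕ) → Prime p → p % 4 ≡ 3 →
    (n : ℕ) →
    pod₃ (p ^ (2 * k) * n + (p ^ (2 * k) ∸ 1) / 4) % 3 ≡ pod₃ n % 3
corollary2 k _ p p-prime p%4≡3 n with p%4≡3⇒p≡2h+1 p p%4≡3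
... | h , refl = pod₃-congruence h p-prime p%4≡3 k n
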